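{- Let $p\equiv 1\pmod 4$ be a prime and $r\geq 1$ an integer. Then $$ \sum_{k=0}^{p^r-1}\left(k-\frac{p^{2r}-1}{4}\right)\frac{\left(\frac12\right)_k^2}{k!^2}\equiv 0\pmod{p^{2r+1}}. $$
   Context: $(x)_k=x(x+1)\cdots(x+k-1)$ denotes the Pochhammer symbol, with $(x)_0=1$. The congruence is understood in the ring $\mathbb{Z}_p$ of $p$-adic integers (the summands are rationals with denominators prime to $p$). -}

module Defs where

open import Data.Nat as ℕ using (ℕ; zero; suc)
open import Data.Nat.Divisibility as ℕD using ()
open import Data.Integer as ℤ using (ℤ)
open import Data.Integer.Divisibility as ℤD using ()
open import Data.Rational as ℚ using (ℚ; _+_; _*_; _-_; _/_; 1ℚ; 0ℚ; ↥_; ↧ₙ_)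
open import Relation.Nullary using (¬_)
open import Data.Product using (_×_)

poch : ℚ → ℕ → ℚ
poch x zero    = 1ℚ
poch x (suc k) = poch x k * (x + (ℤ.+ k) / 1)

invFact : ℕ → ℚ
invFact zero    = 1ℚ
invFact (suc k) = invFact k * (ℤ.+ 1 / suc k)

sumTo : ℕ → (ℕ → ℚ) → ℚ
sumTo zero    f = 0ℚ
sumTo (suc n) f = sumTo n f + f n

-- x ≡ 0 (mod p^m) in ℤ_p, for x ∈ ℚ: x ∈ p^m ℤ_p, i.e. in lowest terms
-- the denominator is prime to p and p^m divides the numerator.
≡0modℤp : ℕ → ℕ → ℚ → Set
≡0modℤp p m x = (¬ (p ℕD.∣ ↧ₙ x)) × (ℤ.+ (p ℕ.^ m) ℤD.∣ ↥ x)

module Submission where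

-- Write a k = ((1/2)_k / k!)², so that 16ᵏ a k = C(2k,k)² and (k+1)² a (k+1) = (k+½)² a k.
-- The recurrence telescopes the sum, for n = pʳ, to n² a n − (n²/4) ∑_{k<n} a k, so 4·16ⁿ
-- times the sum is n² Δ n with Δ n = 4 C(2n,n)² − ∑_{k<n} C(2k,k)² 16^(n−k) an integer;
-- as 4·16ⁿ is a p-adic unit and n² = p^(2r), it remains to show p ∣ Δ(pʳ).
-- Modulo p = 2m+1, Lucas' theorem makes C(2k,k) multiplicative in the base-p digits of k,
-- whence C(2pʳ,pʳ) ≡ 2 and ∑_{k<pʳ} C(2k,k)² 16^(−k) ≡ (∑_{k<p} C(2k,k)² 16^(−k))ʳ.
-- For k < p, C(2k,k) ≡ (−4)ᵏ C(m,k), so the inner sum is ∑ C(m,k)² = C(2m,m) ≡ (−1)ᵐ,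
-- which is 1 as p ≡ 1 (mod 4). As also 16^(−pʳ) ≡ 16⁻¹, we get
-- 16^(−n) Δ n ≡ 16⁻¹ · 4 · 2² − 1 ≡ 0.

module Integers where

  open import Data.Integer as ℤ using (ℤ; +_; _+_; _*_; _-_; -_; -1ℤ)
  open import Data.Integer.Divisibility.Signed as ℤD using (divides)
  import Data.Integer.Properties as ℤP
  import Data.Integer.Tactic.RingSolver as ℤSolver
  open import Algebra.Properties.CommutativeSemigroup ℤP.+-commutativeSemigroup
    using () renaming (interchange to +-interchange; x∙yz≈y∙xz to x+[y+z]≡y+[x+z])
  open import Algebra.Properties.CommutativeSemigroup ℤP.*-commutativeSemigroup
    using () renaming (interchange to *-interchange; xy∙z≈y∙xz to x*y*z≡y*[x*z])
  open import Data.Nat as ℕ using (ℕ; zero; suc; _<_; _≤_; s≤s; z≤n; _^_)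
  open import Data.Nat.Combinatorics
    using (_C_; nCk+nC[k+1]≡[n+1]C[k+1]; nC1≡n; nCn≡1; nCk≡nC[n∸k]; k>n⇒nCk≡0)
  import Data.Nat.Divisibility as ℕD
  open import Data.Nat.Primality using (Prime; euclidsLemma; prime⇒nonZero; prime⇒nonTrivial)
  import Data.Nat.Properties as ℕP
  import Data.Nat.Tactic.RingSolver as ℕSolver
  open import Data.Sum using (inj₁; inj₂)
  open import Relation.Binary.Bundles using (Setoid)
  open import Relation.Binary.PropositionalEquality
  import Relation.Binary.Reasoning.Setoid as SetoidReasoning
  open import Relation.Binary.Structures using (IsEquivalence)
  open import Relation.Nullary using (¬_; yes; no; contradiction)

  ∑< : ℕ → (ℕ → ℤ) → ℤ
  ∑< zero    f = + 0
  ∑< (suc n) f = ∑< n f + f n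

  infixr 10 ∑<
  syntax ∑< n (λ i → f) = ∑[ i < n ] f

  ∑-cong : ∀ n {f g : ℕ → ℤ} → (∀ i → i < n → f i ≡ g i) → ∑< n f ≡ ∑< n g
  ∑-cong zero    f≡g = refl
  ∑-cong (suc n) f≡g = cong₂ _+_ (∑-cong n λ i i<n → f≡g i (ℕP.m<n⇒m<1+n i<n)) (f≡g n ℕP.≤-refl)

  ∑-zero : ∀ n → ∑[ i < n ] (+ 0) ≡ + 0
  ∑-zero zero    = refl
  ∑-zero (suc n) = trans (ℤP.+-identityʳ _) (∑-zero n)

  ∑-distrib-+ : ∀ n (f g : ℕ → ℤ) → ∑[ i < n ] (f i + g i) ≡ ∑< n f + ∑< n g
  ∑-distrib-+ zero    f g = refl
  ∑-distrib-+ (suc n) f g = begin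
    ∑[ i < n ] (f i + g i) + (f n + g n) ≡⟨ cong (_+ (f n + g n)) (∑-distrib-+ n f g) ⟩
    ∑< n f + ∑< n g + (f n + g n)        ≡⟨ +-interchange (∑< n f) (∑< n g) (f n) (g n) ⟩
    ∑< n f + f n + (∑< n g + g n)        ∎
    where open ≡-Reasoning

  ∑-distribʳ-* : ∀ n (f : ℕ → ℤ) x → ∑[ i < n ] (f i * x) ≡ ∑< n f * x
  ∑-distribʳ-* zero    f x = sym (ℤP.*-zeroˡ x)
  ∑-distribʳ-* (suc n) f x =
    trans (cong (_+ f n * x) (∑-distribʳ-* n f x)) (sym (ℤP.*-distribʳ-+ x (∑< n f) (f n)))

  ∑-distribˡ-* : ∀ n (f : ℕ → ℤ) x → ∑[ i < n ] (x * f i) ≡ x * ∑< n f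
  ∑-distribˡ-* zero    f x = sym (ℤP.*-zeroʳ x)
  ∑-distribˡ-* (suc n) f x =
    trans (cong (_+ x * f n) (∑-distribˡ-* n f x)) (sym (ℤP.*-distribˡ-+ x (∑< n f) (f n)))

  ∑-head : ∀ n (f : ℕ → ℤ) → ∑< (suc n) f ≡ f 0 + ∑[ i < n ] f (suc i)
  ∑-head zero    f = trans (ℤP.+-identityˡ (f 0)) (sym (ℤP.+-identityʳ (f 0)))
  ∑-head (suc n) f = trans (cong (_+ f (suc n)) (∑-head n f)) (ℤP.+-assoc (f 0) _ _)

  ∑-split : ∀ a b (f : ℕ → ℤ) → ∑< (a ℕ.+ b) f ≡ ∑< a f + ∑[ i < b ] f (a ℕ.+ i)
  ∑-split a zero    f = trans (cong (λ n → ∑< n f) (ℕP.+-identityʳ a)) (sym (ℤP.+-identityʳ _))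
  ∑-split a (suc b) f = begin
    ∑< (a ℕ.+ suc b) f                                      ≡⟨ cong (λ n → ∑< n f) (ℕP.+-suc a b) ⟩
    ∑< (a ℕ.+ b) f + f (a ℕ.+ b)                            ≡⟨ cong (_+ f (a ℕ.+ b)) (∑-split a b f) ⟩
    ∑< a f + ∑[ i < b ] f (a ℕ.+ i) + f (a ℕ.+ b)           ≡⟨ ℤP.+-assoc (∑< a f) _ _ ⟩
    ∑< a f + ∑[ i < suc b ] f (a ℕ.+ i)                     ∎
    where open ≡-Reasoning

  ∑-blocks : ∀ p N (f : ℕ → ℤ) → ∑< (p ℕ.* N) f ≡ ∑[ j < N ] ∑[ i < p ] f (i ℕ.+ p ℕ.* j)
  ∑-blocks p zero    f = cong (λ n → ∑< n f) (ℕP.*-zeroʳ p)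
  ∑-blocks p (suc N) f = begin
    ∑< (p ℕ.* suc N) f                                 ≡⟨ cong (λ n → ∑< n f) (trans (ℕP.*-suc p N) (ℕP.+-comm p (p ℕ.* N))) ⟩
    ∑< (p ℕ.* N ℕ.+ p) f                               ≡⟨ ∑-split (p ℕ.* N) p f ⟩
    ∑< (p ℕ.* N) f + ∑[ i < p ] f (p ℕ.* N ℕ.+ i)       ≡⟨ cong₂ _+_ (∑-blocks p N f) (∑-cong p λ i _ → cong f (ℕP.+-comm (p ℕ.* N) i)) ⟩
    ∑[ j < suc N ] ∑[ i < p ] f (i ℕ.+ p ℕ.* j)          ∎
    where open ≡-Reasoning

  pascal : ∀ n k → suc n C suc k ≡ n C k ℕ.+ n C suc k
  pascal n k = sym (nCk+nC[k+1]≡[n+1]C[k+1] n k)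

  [1+k]*[1+n]C[1+k]≡[1+n]*nCk : ∀ n k → suc k ℕ.* (suc n C suc k) ≡ suc n ℕ.* (n C k)
  [1+k]*[1+n]C[1+k]≡[1+n]*nCk n zero = trans (ℕP.*-identityˡ _) (trans (nC1≡n (suc n)) (sym (ℕP.*-identityʳ (suc n))))
  [1+k]*[1+n]C[1+k]≡[1+n]*nCk zero (suc k) = ℕP.*-zeroʳ (suc (suc k))
  [1+k]*[1+n]C[1+k]≡[1+n]*nCk (suc n) (suc k) = begin
    (2 ℕ.+ k) ℕ.* ((2 ℕ.+ n) C (2 ℕ.+ k))                               ≡⟨ cong ((2 ℕ.+ k) ℕ.*_) (pascal (suc n) (suc k)) ⟩
    (2 ℕ.+ k) ℕ.* (suc n C suc k ℕ.+ suc n C (2 ℕ.+ k))                ≡⟨ expand k (suc n C suc k) (suc n C (2 ℕ.+ k)) ⟩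
    suc k ℕ.* (suc n C suc k) ℕ.+ suc n C suc k ℕ.+ (2 ℕ.+ k) ℕ.* (suc n C (2 ℕ.+ k))
        ≡⟨ cong₂ (λ x y → x ℕ.+ suc n C suc k ℕ.+ y) ([1+k]*[1+n]C[1+k]≡[1+n]*nCk n k) ([1+k]*[1+n]C[1+k]≡[1+n]*nCk n (suc k)) ⟩
    suc n ℕ.* (n C k) ℕ.+ suc n C suc k ℕ.+ suc n ℕ.* (n C suc k)      ≡⟨ cong (λ x → suc n ℕ.* (n C k) ℕ.+ x ℕ.+ suc n ℕ.* (n C suc k)) (pascal n k) ⟩
    suc n ℕ.* (n C k) ℕ.+ (n C k ℕ.+ n C suc k) ℕ.+ suc n ℕ.* (n C suc k) ≡⟨ collect n (n C k) (n C suc k) ⟩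
    (2 ℕ.+ n) ℕ.* (n C k ℕ.+ n C suc k)                                ≡⟨ cong ((2 ℕ.+ n) ℕ.*_) (pascal n k) ⟨
    (2 ℕ.+ n) ℕ.* (suc n C suc k)                                      ∎
    where
    open ≡-Reasoning
    expand : ∀ k x y → (2 ℕ.+ k) ℕ.* (x ℕ.+ y) ≡ suc k ℕ.* x ℕ.+ x ℕ.+ (2 ℕ.+ k) ℕ.* y
    expand = ℕSolver.solve-∀
    collect : ∀ n x y → suc n ℕ.* x ℕ.+ (x ℕ.+ y) ℕ.+ suc n ℕ.* y ≡ (2 ℕ.+ n) ℕ.* (x ℕ.+ y)
    collect = ℕSolver.solve-∀

  central : ℕ → ℕ
  central k = (k ℕ.+ k) C k

  [1+k]*central[1+k]≡2[2k+1]*central[k] : ∀ k → suc k ℕ.* central (suc k) ≡ 2 ℕ.* (suc (k ℕ.+ k) ℕ.* central k)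
  [1+k]*central[1+k]≡2[2k+1]*central[k] k = begin
    suc k ℕ.* ((suc k ℕ.+ suc k) C suc k)   ≡⟨ cong (λ n → suc k ℕ.* (n C suc k)) (ℕP.+-suc (suc k) k) ⟩
    suc k ℕ.* (suc n C suc k)              ≡⟨ [1+k]*[1+n]C[1+k]≡[1+n]*nCk n k ⟩
    suc n ℕ.* (n C k)                      ≡⟨ cong (suc n ℕ.*_) (nCk≡nC[n∸k] (ℕP.m≤n+m k (suc k))) ⟩
    suc n ℕ.* (n C (n ℕ.∸ k))              ≡⟨ cong (λ i → suc n ℕ.* (n C i)) (ℕP.m+n∸n≡m (suc k) k) ⟩
    suc n ℕ.* (n C suc k)                  ≡⟨ rearrange k (n C suc k) ⟩
    2 ℕ.* (suc k ℕ.* (n C suc k))          ≡⟨ cong (2 ℕ.*_) ([1+k]*[1+n]C[1+k]≡[1+n]*nCk (k ℕ.+ k) k) ⟩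
    2 ℕ.* (n ℕ.* central k)                ∎
    where
    open ≡-Reasoning
    n = suc (k ℕ.+ k)
    rearrange : ∀ k x → (2 ℕ.+ (k ℕ.+ k)) ℕ.* x ≡ 2 ℕ.* (suc k ℕ.* x)
    rearrange = ℕSolver.solve-∀

  pascalℤ : ∀ n k → + (suc n C suc k) ≡ + (n C k) + + (n C suc k)
  pascalℤ n k = trans (cong +_ (pascal n k)) (ℤP.pos-+ (n C k) (n C suc k))

  vandermonde : ∀ a b k → ∑[ i < suc k ] (+ (a C i) * + (b C (k ℕ.∸ i))) ≡ + ((a ℕ.+ b) C k)
  vandermonde zero b k = begin
    ∑[ i < suc k ] (+ (0 C i) * + (b C (k ℕ.∸ i)))            ≡⟨ ∑-head k (λ i → + (0 C i) * + (b C (k ℕ.∸ i))) ⟩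
    + 1 * + (b C k) + ∑[ i < k ] (+ 0 * + (b C (k ℕ.∸ suc i))) ≡⟨ cong₂ _+_ (ℤP.*-identityˡ (+ (b C k))) (trans (∑-cong k λ i _ → ℤP.*-zeroˡ (+ (b C (k ℕ.∸ suc i)))) (∑-zero k)) ⟩
    + (b C k) + + 0                                           ≡⟨ ℤP.+-identityʳ (+ (b C k)) ⟩
    + (b C k)                                                 ∎
    where open ≡-Reasoning
  vandermonde (suc a) b zero = refl
  vandermonde (suc a) b (suc k) = begin
    ∑[ i < suc (suc k) ] (+ (suc a C i) * + (b C (suc k ℕ.∸ i)))
      ≡⟨ ∑-head (suc k) _ ⟩
    + 1 * B₀ + ∑[ j < suc k ] (+ (suc a C suc j) * + (b C (k ℕ.∸ j)))
      ≡⟨ cong (_+_ (+ 1 * B₀)) (∑-cong (suc k) λ j _ → trans (cong (_* + (b C (k ℕ.∸ j))) (pascalℤ a j)) (ℤP.*-distribʳ-+ (+ (b C (k ℕ.∸ j))) (+ (a C j)) (+ (a C suc j)))) ⟩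
    + 1 * B₀ + ∑[ j < suc k ] (X j + Y j)
      ≡⟨ cong (_+_ (+ 1 * B₀)) (∑-distrib-+ (suc k) X Y) ⟩
    + 1 * B₀ + (∑< (suc k) X + ∑< (suc k) Y)
      ≡⟨ x+[y+z]≡y+[x+z] (+ 1 * B₀) (∑< (suc k) X) (∑< (suc k) Y) ⟩
    ∑< (suc k) X + (+ 1 * B₀ + ∑< (suc k) Y)
      ≡⟨ cong (_+_ (∑< (suc k) X)) (∑-head (suc k) _) ⟨
    ∑< (suc k) X + ∑[ i < suc (suc k) ] (+ (a C i) * + (b C (suc k ℕ.∸ i)))
      ≡⟨ cong₂ _+_ (vandermonde a b k) (vandermonde a b (suc k)) ⟩
    + ((a ℕ.+ b) C k) + + ((a ℕ.+ b) C suc k)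
      ≡⟨ pascalℤ (a ℕ.+ b) k ⟨
    + ((suc a ℕ.+ b) C suc k) ∎
    where
    open ≡-Reasoning
    B₀ = + (b C suc k)
    X Y : ℕ → ℤ
    X j = + (a C j) * + (b C (k ℕ.∸ j))
    Y j = + (a C suc j) * + (b C (k ℕ.∸ j))

  ∑-binomial : ∀ n → ∑[ k < suc n ] (+ (n C k)) ≡ (+ 2) ℤ.^ n
  ∑-binomial zero = refl
  ∑-binomial (suc n) = begin
    ∑[ k < suc (suc n) ] (+ (suc n C k))                          ≡⟨ ∑-head (suc n) _ ⟩
    + 1 + ∑[ j < suc n ] (+ (suc n C suc j))                    ≡⟨ cong (_+_ (+ 1)) (trans (∑-cong (suc n) λ j _ → pascalℤ n j) (∑-distrib-+ (suc n) _ _)) ⟩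
    + 1 + (S + ∑[ j < suc n ] (+ (n C suc j)))                 ≡⟨ x+[y+z]≡y+[x+z] (+ 1) S _ ⟩
    S + (+ 1 + ∑[ j < suc n ] (+ (n C suc j)))                 ≡⟨ cong (_+_ S) (∑-head (suc n) _) ⟨
    S + ∑[ k < suc (suc n) ] (+ (n C k))                         ≡⟨ cong (λ x → S + (S + x)) (cong +_ (k>n⇒nCk≡0 (ℕP.n<1+n n))) ⟩
    S + (S + + 0)                                               ≡⟨ cong (_+_ S) (ℤP.+-identityʳ S) ⟩
    S + S                                                       ≡⟨ cong (λ x → x + x) (∑-binomial n) ⟩
    (+ 2) ℤ.^ n + (+ 2) ℤ.^ n                                       ≡⟨ x+x≡2x ((+ 2) ℤ.^ n) ⟩
    (+ 2) ℤ.^ suc n                                               ∎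
    where
    open ≡-Reasoning
    S = ∑[ k < suc n ] (+ (n C k))
    x+x≡2x : ∀ x → x + x ≡ + 2 * x
    x+x≡2x = ℤSolver.solve-∀

  [1+k]*nC[1+k]≡[n-k]*nCk : ∀ n k → + suc k * + (n C suc k) ≡ (+ n - + k) * + (n C k)
  [1+k]*nC[1+k]≡[n-k]*nCk n k = begin
    K * B                 ≡⟨ isolate K A B ⟩
    K * (A + B) - K * A   ≡⟨ cong (λ z → z - K * A) absorption ⟩
    + suc n * A - K * A   ≡⟨ factor (+ n) (+ k) A ⟩
    (+ n - + k) * A       ∎
    where
    open ≡-Reasoning
    K = + suc k
    A = + (n C k)
    B = + (n C suc k)
    absorption : K * (A + B) ≡ + suc n * A
    absorption = begin
      K * (A + B)               ≡⟨ cong (K *_) (pascalℤ n k) ⟨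
      K * + (suc n C suc k)     ≡⟨ ℤP.pos-* (suc k) (suc n C suc k) ⟨
      + (suc k ℕ.* (suc n C suc k)) ≡⟨ cong +_ ([1+k]*[1+n]C[1+k]≡[1+n]*nCk n k) ⟩
      + (suc n ℕ.* (n C k))     ≡⟨ ℤP.pos-* (suc n) (n C k) ⟩
      + suc n * A               ∎
    isolate : ∀ K A B → K * B ≡ K * (A + B) - K * A
    isolate = ℤSolver.solve-∀
    factor : ∀ n k A → (+ 1 + n) * A - (+ 1 + k) * A ≡ (n - k) * A
    factor = ℤSolver.solve-∀

  ^-distribʳ-* : ∀ a b n → (a * b) ℤ.^ n ≡ a ℤ.^ n * b ℤ.^ n
  ^-distribʳ-* a b zero    = refl
  ^-distribʳ-* a b (suc n) = trans (cong (a * b *_) (^-distribʳ-* a b n)) (*-interchange a b (a ℤ.^ n) (b ℤ.^ n))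

  pos-^ : ∀ m n → + (m ^ n) ≡ (+ m) ℤ.^ n
  pos-^ m zero    = refl
  pos-^ m (suc n) = trans (ℤP.pos-* m (m ^ n)) (cong (+ m ℤ.*_) (pos-^ m n))

  [-1]^[t+t]≡1 : ∀ t → -1ℤ ℤ.^ (t ℕ.+ t) ≡ ℤ.+ 1
  [-1]^[t+t]≡1 t = begin
    -1ℤ ℤ.^ (t ℕ.+ t)                 ≡⟨ ℤP.^-distribˡ-+-* -1ℤ t t ⟩
    -1ℤ ℤ.^ t ℤ.* -1ℤ ℤ.^ t           ≡⟨ ^-distribʳ-* -1ℤ -1ℤ t ⟨
    (ℤ.+ 1) ℤ.^ t                     ≡⟨ ℤP.^-zeroˡ t ⟩
    ℤ.+ 1                             ∎
    where open ≡-Reasoning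

  module Modulo (n : ℕ) where

    infix 4 _≈_
    record _≈_ (a b : ℤ) : Set where
      constructor mod
      field n∣a-b : + n ℤD.∣ a - b

    ≡⇒≈ : ∀ {a b} → a ≡ b → a ≈ b
    ≡⇒≈ {a} refl = mod (divides (+ 0) (ℤP.+-inverseʳ a))

    ≈-refl : ∀ {a} → a ≈ a
    ≈-refl = ≡⇒≈ refl

    ≈-sym : ∀ {a b} → a ≈ b → b ≈ a
    ≈-sym {a} {b} (mod n∣a-b) = mod (subst (+ n ℤD.∣_) (-[a-b]≡b-a a b) (ℤD.∣m⇒∣-m n∣a-b))
      where
      -[a-b]≡b-a : ∀ a b → - (a - b) ≡ b - a
      -[a-b]≡b-a = ℤSolver.solve-∀

    ≈-trans : ∀ {a b c} → a ≈ b → b ≈ c → a ≈ c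
    ≈-trans {a} {b} {c} (mod n∣a-b) (mod n∣b-c) = mod (subst (+ n ℤD.∣_) ([a-b]+[b-c]≡a-c a b c) (ℤD.∣m∣n⇒∣m+n n∣a-b n∣b-c))
      where
      [a-b]+[b-c]≡a-c : ∀ a b c → (a - b) + (b - c) ≡ a - c
      [a-b]+[b-c]≡a-c = ℤSolver.solve-∀

    ≈-isEquivalence : IsEquivalence _≈_
    ≈-isEquivalence = record { refl = ≈-refl ; sym = ≈-sym ; trans = ≈-trans }

    ≈-setoid : Setoid _ _
    ≈-setoid = record { isEquivalence = ≈-isEquivalence }

    module ≈-Reasoning = SetoidReasoning ≈-setoid

    +-cong : ∀ {a b c d} → a ≈ b → c ≈ d → a + c ≈ b + d
    +-cong {a} {b} {c} {d} (mod n∣a-b) (mod n∣c-d) = mod (subst (+ n ℤD.∣_) ([a-b]+[c-d]≡[a+c]-[b+d] a b c d) (ℤD.∣m∣n⇒∣m+n n∣a-b n∣c-d))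
      where
      [a-b]+[c-d]≡[a+c]-[b+d] : ∀ a b c d → (a - b) + (c - d) ≡ (a + c) - (b + d)
      [a-b]+[c-d]≡[a+c]-[b+d] = ℤSolver.solve-∀

    -‿cong : ∀ {a b} → a ≈ b → - a ≈ - b
    -‿cong {a} {b} (mod n∣a-b) = mod (subst (+ n ℤD.∣_) (-[a-b]≡-a--b a b) (ℤD.∣m⇒∣-m n∣a-b))
      where
      -[a-b]≡-a--b : ∀ a b → - (a - b) ≡ - a - - b
      -[a-b]≡-a--b = ℤSolver.solve-∀

    *-cong : ∀ {a b c d} → a ≈ b → c ≈ d → a * c ≈ b * d
    *-cong {a} {b} {c} {d} (mod n∣a-b) (mod n∣c-d) =
      mod (subst (+ n ℤD.∣_) ([a-b]c+b[c-d]≡ac-bd a b c d) (ℤD.∣m∣n⇒∣m+n (ℤD.∣m⇒∣m*n c n∣a-b) (ℤD.∣n⇒∣m*n b n∣c-d)))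
      where
      [a-b]c+b[c-d]≡ac-bd : ∀ a b c d → (a - b) * c + b * (c - d) ≡ a * c - b * d
      [a-b]c+b[c-d]≡ac-bd = ℤSolver.solve-∀

    *-congˡ : ∀ x {a b} → a ≈ b → x * a ≈ x * b
    *-congˡ x = *-cong (≈-refl {x})

    *-congʳ : ∀ x {a b} → a ≈ b → a * x ≈ b * x
    *-congʳ x a≈b = *-cong a≈b (≈-refl {x})

    ^-cong : ∀ {a b} k → a ≈ b → a ℤ.^ k ≈ b ℤ.^ k
    ^-cong zero    a≈b = ≈-refl
    ^-cong (suc k) a≈b = *-cong a≈b (^-cong k a≈b)

    ∑-cong-≈ : ∀ k {f g : ℕ → ℤ} → (∀ i → i < k → f i ≈ g i) → ∑< k f ≈ ∑< k g
    ∑-cong-≈ zero    f≈g = ≈-refl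
    ∑-cong-≈ (suc k) f≈g = +-cong (∑-cong-≈ k λ i i<k → f≈g i (ℕP.m<n⇒m<1+n i<k)) (f≈g k ℕP.≤-refl)

    n≈0 : + n ≈ + 0
    n≈0 = mod (divides (+ 1) (trans (ℤP.+-identityʳ (+ n)) (sym (ℤP.*-identityˡ (+ n)))))

    ∣⇒≈0 : ∀ {m} → n ℕD.∣ m → + m ≈ + 0
    ∣⇒≈0 {m} (ℕD.divides q m≡q*n) = mod (divides (+ q) (trans (ℤP.+-identityʳ (+ m)) (trans (cong +_ m≡q*n) (ℤP.pos-* q n))))

    ≈0⇒∣ : ∀ {a} → a ≈ + 0 → n ℕD.∣ ℤ.∣ a ∣
    ≈0⇒∣ {a} (mod n∣a-0) = ℤD.∣⇒∣ᵤ (subst (+ n ℤD.∣_) (ℤP.+-identityʳ a) n∣a-0)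

    *-cancelˡ-≈ : ∀ x y {a b} → x * y ≈ + 1 → x * a ≈ x * b → a ≈ b
    *-cancelˡ-≈ x y {a} {b} xy≈1 xa≈xb = begin
      a               ≡⟨ ℤP.*-identityˡ a ⟨
      + 1 * a         ≈⟨ *-congʳ a (≈-sym xy≈1) ⟩
      x * y * a       ≡⟨ x*y*z≡y*[x*z] x y a ⟩
      y * (x * a)     ≈⟨ *-congˡ y xa≈xb ⟩
      y * (x * b)     ≡⟨ x*y*z≡y*[x*z] x y b ⟨
      x * y * b       ≈⟨ *-congʳ b xy≈1 ⟩
      + 1 * b         ≡⟨ ℤP.*-identityˡ b ⟩
      b               ∎
      where open ≈-Reasoning

    ∑-multiplicative : ∀ {g : ℕ → ℤ} → (∀ j {i} → i < n → g (i ℕ.+ n ℕ.* j) ≈ g i * g j) →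
                       ∀ N → ∑< (n ℕ.* N) g ≈ ∑< n g * ∑< N g
    ∑-multiplicative {g} g-mult N = begin
      ∑< (n ℕ.* N) g                        ≡⟨ ∑-blocks n N g ⟩
      ∑[ j < N ] ∑[ i < n ] g (i ℕ.+ n ℕ.* j) ≈⟨ ∑-cong-≈ N (λ j _ → ∑-cong-≈ n λ i i<n → g-mult j i<n) ⟩
      ∑[ j < N ] ∑[ i < n ] (g i * g j)      ≡⟨ ∑-cong N (λ j _ → ∑-distribʳ-* n g (g j)) ⟩
      ∑[ j < N ] (∑< n g * g j)             ≡⟨ ∑-distribˡ-* N g (∑< n g) ⟩
      ∑< n g * ∑< N g                       ∎
      where open ≈-Reasoning

  module ModuloPrime {p} (prime : Prime p) where
    open Modulo p

    *-cancelˡ-≈-prime : ∀ x {a b} → ¬ (p ℕD.∣ x) → + x * a ≈ + x * b → a ≈ b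
    *-cancelˡ-≈-prime x {a} {b} p∤x (mod p∣xa-xb) with euclidsLemma x ℤ.∣ a - b ∣ prime p∣x∣a-b∣
      where
      xa-xb≡x[a-b] : ∀ x a b → x * a - x * b ≡ x * (a - b)
      xa-xb≡x[a-b] = ℤSolver.solve-∀
      p∣x∣a-b∣ : p ℕD.∣ x ℕ.* ℤ.∣ a - b ∣
      p∣x∣a-b∣ = subst (p ℕD.∣_) (ℤP.abs-* (+ x) (a - b)) (ℤD.∣⇒∣ᵤ (subst (+ p ℤD.∣_) (xa-xb≡x[a-b] (+ x) a b) p∣xa-xb))
    ... | inj₁ p∣x   = contradiction p∣x p∤x
    ... | inj₂ p∣a-b = mod (ℤD.∣ᵤ⇒∣ p∣a-b)

    -- The recurrences force x k ≡ (−1)ᵏ y k; comparing squares avoids tracking the sign.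
    squares-≈ : ∀ (x y a : ℕ → ℤ) → x 0 ≡ y 0 →
                (∀ k → + suc k * x (suc k) ≡ a k * x k) → (∀ k → + suc k * y (suc k) ≈ - a k * y k) →
                ∀ k → k < p → x k * x k ≈ y k * y k
    squares-≈ x y a x₀≡y₀ x-rec y-rec zero    _     = ≡⇒≈ (cong (λ z → z * z) x₀≡y₀)
    squares-≈ x y a x₀≡y₀ x-rec y-rec (suc k) 1+k<p = *-cancelˡ-≈-prime (suc k ℕ.* suc k) p∤[1+k]² (begin
      + (suc k ℕ.* suc k) * (x (suc k) * x (suc k))   ≡⟨ cong (_* (x (suc k) * x (suc k))) (ℤP.pos-* (suc k) (suc k)) ⟩
      (K * K) * (x (suc k) * x (suc k))               ≡⟨ *-interchange K K (x (suc k)) (x (suc k)) ⟩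
      (K * x (suc k)) * (K * x (suc k))               ≡⟨ cong (λ z → z * z) (x-rec k) ⟩
      (a k * x k) * (a k * x k)                       ≡⟨ *-interchange (a k) (x k) (a k) (x k) ⟩
      (a k * a k) * (x k * x k)                       ≈⟨ *-congˡ (a k * a k) (squares-≈ x y a x₀≡y₀ x-rec y-rec k (ℕP.<-trans (ℕP.n<1+n k) 1+k<p)) ⟩
      (a k * a k) * (y k * y k)                       ≡⟨ square-neg (a k) (y k) ⟩
      (- a k * y k) * (- a k * y k)                   ≈⟨ ≈-sym (*-cong (y-rec k) (y-rec k)) ⟩
      (K * y (suc k)) * (K * y (suc k))               ≡⟨ *-interchange K K (y (suc k)) (y (suc k)) ⟨
      (K * K) * (y (suc k) * y (suc k))               ≡⟨ cong (_* (y (suc k) * y (suc k))) (ℤP.pos-* (suc k) (suc k)) ⟨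
      + (suc k ℕ.* suc k) * (y (suc k) * y (suc k))   ∎)
      where
      open ≈-Reasoning
      K = + suc k
      square-neg : ∀ a y → (a * a) * (y * y) ≡ (- a * y) * (- a * y)
      square-neg = ℤSolver.solve-∀
      p∤1+k : ¬ (p ℕD.∣ suc k)
      p∤1+k p∣1+k = ℕP.<⇒≱ 1+k<p (ℕD.∣⇒≤ p∣1+k)
      p∤[1+k]² : ¬ (p ℕD.∣ suc k ℕ.* suc k)
      p∤[1+k]² p∣[1+k]² with euclidsLemma (suc k) (suc k) prime p∣[1+k]²
      ... | inj₁ p∣1+k = p∤1+k p∣1+k
      ... | inj₂ p∣1+k = p∤1+k p∣1+k

    p∤a⇒p∤a^k : ∀ {a} → ¬ p ℕD.∣ a → ∀ k → ¬ p ℕD.∣ a ^ k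
    p∤a⇒p∤a^k p∤a zero    p∣1 = ℕP.<⇒≢ (ℕ.nonTrivial⇒n>1 p {{prime⇒nonTrivial prime}}) (sym (ℕD.∣1⇒≡1 p∣1))
    p∤a⇒p∤a^k {a} p∤a (suc k) p∣a*a^k with euclidsLemma a (a ^ k) prime p∣a*a^k
    ... | inj₁ p∣a   = p∤a p∣a
    ... | inj₂ p∣a^k = p∤a⇒p∤a^k p∤a k p∣a^k

    p^e∣m*n⇒p^e∣m : ∀ {n} → ¬ p ℕD.∣ n → ∀ e m → p ^ e ℕD.∣ m ℕ.* n → p ^ e ℕD.∣ m
    p^e∣m*n⇒p^e∣m p∤n zero    m _ = ℕD.1∣ m
    p^e∣m*n⇒p^e∣m {n} p∤n (suc e) m p^[1+e]∣mn with euclidsLemma m n prime (ℕD.∣-trans (ℕD.m∣m*n (p ^ e)) p^[1+e]∣mn)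
    ... | inj₂ p∣n = contradiction p∣n p∤n
    ... | inj₁ (ℕD.divides q refl) = subst (p ℕ.* p ^ e ℕD.∣_) (ℕP.*-comm p q) (ℕD.*-monoʳ-∣ p (p^e∣m*n⇒p^e∣m p∤n e q p^e∣qn))
      where
      instance _ = prime⇒nonZero prime
      p^e∣qn : p ^ e ℕD.∣ q ℕ.* n
      p^e∣qn = ℕD.*-cancelˡ-∣ p (subst (p ℕ.* p ^ e ℕD.∣_) (trans (cong (ℕ._* n) (ℕP.*-comm q p)) (ℕP.*-assoc p q n)) p^[1+e]∣mn)

  module Lucas (p-1 : ℕ) (prime : Prime (suc p-1)) where

    p : ℕ
    p = suc p-1

    open Modulo p

    p∣pC[1+k] : ∀ {k} → suc k < p → p ℕD.∣ p C suc k
    p∣pC[1+k] {k} 1+k<p with euclidsLemma (suc k) (p C suc k) prime p∣[1+k]*pC[1+k]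
      where
      p∣[1+k]*pC[1+k] : p ℕD.∣ suc k ℕ.* (p C suc k)
      p∣[1+k]*pC[1+k] = subst (p ℕD.∣_) (sym ([1+k]*[1+n]C[1+k]≡[1+n]*nCk p-1 k)) (ℕD.m∣m*n (p-1 C k))
    ... | inj₁ p∣1+k   = contradiction (ℕD.∣⇒≤ p∣1+k) (ℕP.<⇒≱ 1+k<p)
    ... | inj₂ p∣pC1+k = p∣pC1+k

    -- Coefficientwise, (1 + x)ⁿ⁺ᵖ ≡ (1 + x)ⁿ (1 + xᵖ).
    [n+p]Ck≈nCk : ∀ n {k} → k < p → + ((n ℕ.+ p) C k) ≈ + (n C k)
    [n+p]Ck≈nCk zero    {zero}  _   = ≈-refl
    [n+p]Ck≈nCk zero    {suc k} k<p = ∣⇒≈0 (p∣pC[1+k] k<p)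
    [n+p]Ck≈nCk (suc n) {zero}  _   = ≈-refl
    [n+p]Ck≈nCk (suc n) {suc k} k<p = begin
      + ((suc n ℕ.+ p) C suc k)                     ≡⟨ pascalℤ (n ℕ.+ p) k ⟩
      + ((n ℕ.+ p) C k) + + ((n ℕ.+ p) C suc k)     ≈⟨ +-cong ([n+p]Ck≈nCk n (ℕP.<-trans (ℕP.n<1+n k) k<p)) ([n+p]Ck≈nCk n k<p) ⟩
      + (n C k) + + (n C suc k)                     ≡⟨ pascalℤ n k ⟨
      + (suc n C suc k)                             ∎
      where open ≈-Reasoning

    [n+p]C[k+p]≈nC[k+p]+nCk : ∀ n k → + ((n ℕ.+ p) C (k ℕ.+ p)) ≈ + (n C (k ℕ.+ p)) + + (n C k)
    [n+p]C[k+p]≈nC[k+p]+nCk zero zero    = ≡⇒≈ (cong +_ (nCn≡1 p))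
    [n+p]C[k+p]≈nC[k+p]+nCk zero (suc k) = ≡⇒≈ (cong +_ (k>n⇒nCk≡0 (ℕP.m<n+m p {suc k} (s≤s z≤n))))
    [n+p]C[k+p]≈nC[k+p]+nCk (suc n) zero = begin
      + ((suc n ℕ.+ p) C p)                               ≡⟨ pascalℤ (n ℕ.+ p) p-1 ⟩
      + ((n ℕ.+ p) C p-1) + + ((n ℕ.+ p) C p)             ≈⟨ +-cong ([n+p]Ck≈nCk n ℕP.≤-refl) ([n+p]C[k+p]≈nC[k+p]+nCk n zero) ⟩
      + (n C p-1) + (+ (n C p) + + 1)                     ≡⟨ ℤP.+-assoc (+ (n C p-1)) (+ (n C p)) (+ 1) ⟨
      + (n C p-1) + + (n C p) + + 1                       ≡⟨ cong (_+ + 1) (pascalℤ n p-1) ⟨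
      + (suc n C p) + + 1                                 ∎
      where open ≈-Reasoning
    [n+p]C[k+p]≈nC[k+p]+nCk (suc n) (suc k) = begin
      + ((suc n ℕ.+ p) C (suc k ℕ.+ p))                               ≡⟨ pascalℤ (n ℕ.+ p) (k ℕ.+ p) ⟩
      + ((n ℕ.+ p) C (k ℕ.+ p)) + + ((n ℕ.+ p) C (suc k ℕ.+ p))       ≈⟨ +-cong ([n+p]C[k+p]≈nC[k+p]+nCk n k) ([n+p]C[k+p]≈nC[k+p]+nCk n (suc k)) ⟩
      (+ (n C (k ℕ.+ p)) + + (n C k)) + (+ (n C (suc k ℕ.+ p)) + + (n C suc k))
                                                                      ≡⟨ +-interchange (+ (n C (k ℕ.+ p))) (+ (n C k)) (+ (n C (suc k ℕ.+ p))) (+ (n C suc k)) ⟩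
      (+ (n C (k ℕ.+ p)) + + (n C (suc k ℕ.+ p))) + (+ (n C k) + + (n C suc k))
                                                                      ≡⟨ cong₂ _+_ (pascalℤ n (k ℕ.+ p)) (pascalℤ n k) ⟨
      + (suc n C (suc k ℕ.+ p)) + + (suc n C suc k)                   ∎
      where open ≈-Reasoning

    private
      i+p*0≡i : ∀ i → i ℕ.+ p ℕ.* 0 ≡ i
      i+p*0≡i i = trans (cong (i ℕ.+_) (ℕP.*-zeroʳ p)) (ℕP.+-identityʳ i)

      i+p*[1+j]≡i+p*j+p : ∀ i j → i ℕ.+ p ℕ.* suc j ≡ i ℕ.+ p ℕ.* j ℕ.+ p
      i+p*[1+j]≡i+p*j+p i j = solve i j p
        where
        solve : ∀ i j p → i ℕ.+ p ℕ.* suc j ≡ i ℕ.+ p ℕ.* j ℕ.+ p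
        solve = ℕSolver.solve-∀

    lucas : ∀ j l {i k} → i < p → k < p → + ((i ℕ.+ p ℕ.* j) C (k ℕ.+ p ℕ.* l)) ≈ + (i C k) * + (j C l)
    lucas zero zero {i} {k} _ _ = ≡⇒≈ (begin
      + ((i ℕ.+ p ℕ.* 0) C (k ℕ.+ p ℕ.* 0))   ≡⟨ cong₂ (λ a b → + (a C b)) (i+p*0≡i i) (i+p*0≡i k) ⟩
      + (i C k)                               ≡⟨ ℤP.*-identityʳ (+ (i C k)) ⟨
      + (i C k) * + 1                         ∎)
      where open ≡-Reasoning
    lucas zero (suc l) {i} {k} i<p _ = ≡⇒≈ (begin
      + ((i ℕ.+ p ℕ.* 0) C (k ℕ.+ p ℕ.* suc l))   ≡⟨ cong +_ (k>n⇒nCk≡0 (ℕP.<-≤-trans i+p*0<p (ℕP.≤-trans (ℕP.m≤m*n p (suc l)) (ℕP.m≤n+m _ k)))) ⟩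
      + 0                                          ≡⟨ ℤP.*-zeroʳ (+ (i C k)) ⟨
      + (i C k) * + 0                              ∎)
      where
      open ≡-Reasoning
      i+p*0<p : i ℕ.+ p ℕ.* 0 < p
      i+p*0<p = subst (_< p) (sym (i+p*0≡i i)) i<p
    lucas (suc j) zero {i} {k} i<p k<p = begin
      + ((i ℕ.+ p ℕ.* suc j) C (k ℕ.+ p ℕ.* 0))   ≡⟨ cong₂ (λ a b → + (a C b)) (i+p*[1+j]≡i+p*j+p i j) (i+p*0≡i k) ⟩
      + ((i ℕ.+ p ℕ.* j ℕ.+ p) C k)               ≈⟨ [n+p]Ck≈nCk (i ℕ.+ p ℕ.* j) k<p ⟩
      + ((i ℕ.+ p ℕ.* j) C k)                     ≡⟨ cong (λ b → + ((i ℕ.+ p ℕ.* j) C b)) (i+p*0≡i k) ⟨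
      + ((i ℕ.+ p ℕ.* j) C (k ℕ.+ p ℕ.* 0))       ≈⟨ lucas j zero i<p k<p ⟩
      + (i C k) * + 1                             ∎
      where open ≈-Reasoning
    lucas (suc j) (suc l) {i} {k} i<p k<p = begin
      + ((i ℕ.+ p ℕ.* suc j) C (k ℕ.+ p ℕ.* suc l))
        ≡⟨ cong₂ (λ a b → + (a C b)) (i+p*[1+j]≡i+p*j+p i j) (i+p*[1+j]≡i+p*j+p k l) ⟩
      + ((i ℕ.+ p ℕ.* j ℕ.+ p) C (k ℕ.+ p ℕ.* l ℕ.+ p))
        ≈⟨ [n+p]C[k+p]≈nC[k+p]+nCk (i ℕ.+ p ℕ.* j) (k ℕ.+ p ℕ.* l) ⟩
      + ((i ℕ.+ p ℕ.* j) C (k ℕ.+ p ℕ.* l ℕ.+ p)) + + ((i ℕ.+ p ℕ.* j) C (k ℕ.+ p ℕ.* l))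
        ≡⟨ cong (λ b → + ((i ℕ.+ p ℕ.* j) C b) + + ((i ℕ.+ p ℕ.* j) C (k ℕ.+ p ℕ.* l))) (i+p*[1+j]≡i+p*j+p k l) ⟨
      + ((i ℕ.+ p ℕ.* j) C (k ℕ.+ p ℕ.* suc l)) + + ((i ℕ.+ p ℕ.* j) C (k ℕ.+ p ℕ.* l))
        ≈⟨ +-cong (lucas j (suc l) i<p k<p) (lucas j l i<p k<p) ⟩
      + (i C k) * + (j C suc l) + + (i C k) * + (j C l)
        ≡⟨ ℤP.*-distribˡ-+ (+ (i C k)) (+ (j C suc l)) (+ (j C l)) ⟨
      + (i C k) * (+ (j C suc l) + + (j C l))
        ≡⟨ cong (+ (i C k) *_) (trans (ℤP.+-comm (+ (j C suc l)) (+ (j C l))) (sym (pascalℤ j l))) ⟩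
      + (i C k) * + (suc j C suc l)
        ∎
      where open ≈-Reasoning

    -- If i + i ≥ p, its last base-p digit is below i, so both sides vanish.
    central-lucas-carry : ∀ j {i} → i < p → p ≤ i ℕ.+ i → + central (i ℕ.+ p ℕ.* j) ≈ + central i * + central j
    central-lucas-carry j {i} i<p p≤2i = begin
      + central (i ℕ.+ p ℕ.* j)                             ≡⟨ cong (λ n → + (n C (i ℕ.+ p ℕ.* j))) double-carry ⟩
      + ((t ℕ.+ p ℕ.* suc (j ℕ.+ j)) C (i ℕ.+ p ℕ.* j))     ≈⟨ lucas (suc (j ℕ.+ j)) j t<p i<p ⟩
      + (t C i) * + (suc (j ℕ.+ j) C j)                     ≡⟨ cong (λ x → + x * + (suc (j ℕ.+ j) C j)) tCi≡0 ⟩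
      + 0 * + (suc (j ℕ.+ j) C j)                           ≡⟨ ℤP.*-zeroˡ (+ (suc (j ℕ.+ j) C j)) ⟩
      + 0                                                   ≡⟨ ℤP.*-zeroˡ (+ central j) ⟨
      + 0 * + central j                                     ≈⟨ *-congʳ (+ central j) (≈-sym central[i]≈0) ⟩
      + central i * + central j                             ∎
      where
      open ≈-Reasoning
      t = i ℕ.+ i ℕ.∸ p
      t+p≡2i : t ℕ.+ p ≡ i ℕ.+ i
      t+p≡2i = ℕP.m∸n+n≡m p≤2i
      t<p : t < p
      t<p = ℕP.+-cancelʳ-< p t p (subst (ℕ._< p ℕ.+ p) (sym t+p≡2i) (ℕP.+-mono-< i<p i<p))
      tCi≡0 : t C i ≡ 0
      tCi≡0 = k>n⇒nCk≡0 (ℕP.+-cancelʳ-< p t i (subst (ℕ._< i ℕ.+ p) (sym t+p≡2i) (ℕP.+-monoʳ-< i i<p)))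
      central[i]≈0 : + central i ≈ + 0
      central[i]≈0 = begin
        + ((i ℕ.+ i) C i)    ≡⟨ cong (λ n → + (n C i)) t+p≡2i ⟨
        + ((t ℕ.+ p) C i)    ≈⟨ [n+p]Ck≈nCk t i<p ⟩
        + (t C i)            ≡⟨ cong +_ tCi≡0 ⟩
        + 0                  ∎
      double-carry : i ℕ.+ p ℕ.* j ℕ.+ (i ℕ.+ p ℕ.* j) ≡ t ℕ.+ p ℕ.* suc (j ℕ.+ j)
      double-carry = trans (rearrange i p j) (trans (cong (ℕ._+ p ℕ.* (j ℕ.+ j)) (sym t+p≡2i)) (rearrange′ t p j))
        where
        rearrange : ∀ i p j → i ℕ.+ p ℕ.* j ℕ.+ (i ℕ.+ p ℕ.* j) ≡ i ℕ.+ i ℕ.+ p ℕ.* (j ℕ.+ j)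
        rearrange = ℕSolver.solve-∀
        rearrange′ : ∀ t p j → t ℕ.+ p ℕ.+ p ℕ.* (j ℕ.+ j) ≡ t ℕ.+ p ℕ.* suc (j ℕ.+ j)
        rearrange′ = ℕSolver.solve-∀

    central-lucas : ∀ j {i} → i < p → + central (i ℕ.+ p ℕ.* j) ≈ + central i * + central j
    central-lucas j {i} i<p with i ℕ.+ i ℕ.<? p
    ... | no 2i≮p = central-lucas-carry j i<p (ℕP.≮⇒≥ 2i≮p)
    ... | yes 2i<p = begin
      + central (i ℕ.+ p ℕ.* j)                             ≡⟨ cong (λ n → + (n C (i ℕ.+ p ℕ.* j))) (double i j p) ⟩
      + ((i ℕ.+ i ℕ.+ p ℕ.* (j ℕ.+ j)) C (i ℕ.+ p ℕ.* j))   ≈⟨ lucas (j ℕ.+ j) j 2i<p i<p ⟩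
      + central i * + central j                             ∎
      where
      open ≈-Reasoning
      double : ∀ i j p → i ℕ.+ p ℕ.* j ℕ.+ (i ℕ.+ p ℕ.* j) ≡ i ℕ.+ i ℕ.+ p ℕ.* (j ℕ.+ j)
      double = ℕSolver.solve-∀

    central[p^r]≈2 : ∀ r → + central (p ^ r) ≈ + 2
    central[p^r]≈2 zero    = ≈-refl
    central[p^r]≈2 (suc r) = begin
      + central (p ℕ.* p ^ r)             ≈⟨ central-lucas (p ^ r) (s≤s z≤n) ⟩
      + central 0 * + central (p ^ r)     ≡⟨ ℤP.*-identityˡ (+ central (p ^ r)) ⟩
      + central (p ^ r)                   ≈⟨ central[p^r]≈2 r ⟩
      + 2                                 ∎
      where open ≈-Reasoning

  odd-prime∤2 : ∀ m → Prime (suc (m ℕ.+ m)) → ¬ suc (m ℕ.+ m) ℕD.∣ 2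
  odd-prime∤2 zero    1-prime _   = ℕP.<-irrefl refl (ℕ.nonTrivial⇒n>1 1 {{prime⇒nonTrivial 1-prime}})
  odd-prime∤2 (suc m) _       p∣2 = ℕP.<⇒≱ (s≤s (s≤s (ℕP.≤-trans (s≤s z≤n) (ℕP.m≤n+m (suc m) m)))) (ℕD.∣⇒≤ p∣2)

  Δ : ℕ → ℤ
  Δ n = + 4 * + central n * + central n - ∑[ k < n ] (+ central k * + central k * (+ 16) ℤ.^ (n ℕ.∸ k))

  module OddPrime (m : ℕ) (prime : Prime (suc (m ℕ.+ m))) where

    open Lucas (m ℕ.+ m) prime public
    open Modulo p
    open ModuloPrime prime using (squares-≈)

    a+b≈0⇒b≈-a : ∀ {a b} → a + b ≈ + 0 → b ≈ - a
    a+b≈0⇒b≈-a {a} {b} a+b≈0 = begin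
      b              ≡⟨ b≡a+b-a a b ⟩
      a + b - a      ≈⟨ +-cong a+b≈0 ≈-refl ⟩
      + 0 - a        ≡⟨ ℤP.+-identityˡ (- a) ⟩
      - a            ∎
      where
      open ≈-Reasoning
      b≡a+b-a : ∀ a b → b ≡ a + b - a
      b≡a+b-a = ℤSolver.solve-∀

    [p-1]Ck≈[-1]^k : ∀ k → k < p → + ((m ℕ.+ m) C k) ≈ -1ℤ ℤ.^ k
    [p-1]Ck≈[-1]^k zero    _     = ≈-refl
    [p-1]Ck≈[-1]^k (suc k) 1+k<p = begin
      + ((m ℕ.+ m) C suc k)          ≈⟨ a+b≈0⇒b≈-a (≈-trans (≡⇒≈ (sym (pascalℤ (m ℕ.+ m) k))) (∣⇒≈0 (p∣pC[1+k] 1+k<p))) ⟩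
      - + ((m ℕ.+ m) C k)            ≈⟨ -‿cong ([p-1]Ck≈[-1]^k k (ℕP.<-trans (ℕP.n<1+n k) 1+k<p)) ⟩
      - (-1ℤ ℤ.^ k)              ≡⟨ ℤP.-1*i≡-i (-1ℤ ℤ.^ k) ⟨
      -1ℤ ℤ.^ suc k              ∎
      where open ≈-Reasoning

    2^p≈2 : (+ 2) ℤ.^ p ≈ + 2
    2^p≈2 = begin
      (+ 2) ℤ.^ p                                                    ≡⟨ ∑-binomial p ⟨
      ∑< p (λ k → + (p C k)) + + (p C p)                             ≡⟨ cong₂ _+_ (∑-head (m ℕ.+ m) (λ k → + (p C k))) (cong +_ (nCn≡1 p)) ⟩
      + 1 + ∑[ k < m ℕ.+ m ] (+ (p C suc k)) + + 1                  ≈⟨ +-cong (+-cong (≈-refl {+ 1}) (∑-cong-≈ (m ℕ.+ m) λ k k<2m → ∣⇒≈0 (p∣pC[1+k] (s≤s k<2m)))) ≈-refl ⟩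
      + 1 + ∑[ k < m ℕ.+ m ] (+ 0) + + 1                           ≡⟨ cong (λ z → + 1 + z + + 1) (∑-zero (m ℕ.+ m)) ⟩
      + 2                                                            ∎
      where open ≈-Reasoning

    2⁻¹ : ℤ
    2⁻¹ = + suc m

    2*2⁻¹≈1 : + 2 * 2⁻¹ ≈ + 1
    2*2⁻¹≈1 = begin
      + 2 * + suc m          ≡⟨ 2[1+m]≡p+1 (+ m) ⟩
      + p + + 1              ≈⟨ +-cong n≈0 (≈-refl {+ 1}) ⟩
      + 1                    ∎
      where
      open ≈-Reasoning
      2[1+m]≡p+1 : ∀ m → + 2 * (+ 1 + m) ≡ (+ 1 + (m + m)) + + 1
      2[1+m]≡p+1 = ℤSolver.solve-∀

    2⁻¹^p≈2⁻¹ : 2⁻¹ ℤ.^ p ≈ 2⁻¹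
    2⁻¹^p≈2⁻¹ = *-cancelˡ-≈ (+ 2) 2⁻¹ 2*2⁻¹≈1 (begin
      + 2 * 2⁻¹ ℤ.^ p                 ≈⟨ *-congʳ (2⁻¹ ℤ.^ p) (≈-sym 2^p≈2) ⟩
      (+ 2) ℤ.^ p * 2⁻¹ ℤ.^ p         ≡⟨ ^-distribʳ-* (+ 2) 2⁻¹ p ⟨
      (+ 2 * 2⁻¹) ℤ.^ p               ≈⟨ ^-cong p 2*2⁻¹≈1 ⟩
      (+ 1) ℤ.^ p                     ≡⟨ ℤP.^-zeroˡ p ⟩
      + 1                             ≈⟨ ≈-sym 2*2⁻¹≈1 ⟩
      + 2 * 2⁻¹                       ∎)
      where open ≈-Reasoning

    16⁻¹ : ℤ
    16⁻¹ = 2⁻¹ ℤ.^ 4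

    16*16⁻¹≈1 : + 16 * 16⁻¹ ≈ + 1
    16*16⁻¹≈1 = begin
      + 16 * 2⁻¹ ℤ.^ 4      ≡⟨ ^-distribʳ-* (+ 2) 2⁻¹ 4 ⟨
      (+ 2 * 2⁻¹) ℤ.^ 4     ≈⟨ ^-cong 4 2*2⁻¹≈1 ⟩
      + 1                   ∎
      where open ≈-Reasoning

    16⁻¹^p≈16⁻¹ : 16⁻¹ ℤ.^ p ≈ 16⁻¹
    16⁻¹^p≈16⁻¹ = begin
      (2⁻¹ ℤ.^ 4) ℤ.^ p     ≡⟨ ℤP.^-*-assoc 2⁻¹ 4 p ⟩
      2⁻¹ ℤ.^ (4 ℕ.* p)     ≡⟨ cong (2⁻¹ ℤ.^_) (ℕP.*-comm 4 p) ⟩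
      2⁻¹ ℤ.^ (p ℕ.* 4)     ≡⟨ ℤP.^-*-assoc 2⁻¹ p 4 ⟨
      (2⁻¹ ℤ.^ p) ℤ.^ 4     ≈⟨ ^-cong 4 2⁻¹^p≈2⁻¹ ⟩
      2⁻¹ ℤ.^ 4             ∎
      where open ≈-Reasoning

    2[m-k]≈-[2k+1] : ∀ k → + 2 * (+ m - + k) ≈ - + suc (k ℕ.+ k)
    2[m-k]≈-[2k+1] k = begin
      + 2 * (+ m - + k)              ≡⟨ shift (+ m) (+ k) ⟩
      + p - + suc (k ℕ.+ k)          ≈⟨ +-cong n≈0 (≈-refl { - + suc (k ℕ.+ k)}) ⟩
      + 0 - + suc (k ℕ.+ k)          ≡⟨ ℤP.+-identityˡ (- + suc (k ℕ.+ k)) ⟩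
      - + suc (k ℕ.+ k)              ∎
      where
      open ≈-Reasoning
      shift : ∀ m k → + 2 * (m - k) ≡ (+ 1 + (m + m)) - (+ 1 + (k + k))
      shift = ℤSolver.solve-∀

    central-rec : ∀ k → + suc k * + central (suc k) ≡ + 2 * + suc (k ℕ.+ k) * + central k
    central-rec k = begin
      + suc k * + central (suc k)                 ≡⟨ ℤP.pos-* (suc k) (central (suc k)) ⟨
      + (suc k ℕ.* central (suc k))               ≡⟨ cong +_ ([1+k]*central[1+k]≡2[2k+1]*central[k] k) ⟩
      + (2 ℕ.* (suc (k ℕ.+ k) ℕ.* central k))     ≡⟨ ℤP.pos-* 2 (suc (k ℕ.+ k) ℕ.* central k) ⟩
      + 2 * + (suc (k ℕ.+ k) ℕ.* central k)       ≡⟨ cong (+ 2 *_) (ℤP.pos-* (suc (k ℕ.+ k)) (central k)) ⟩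
      + 2 * (+ suc (k ℕ.+ k) * + central k)       ≡⟨ ℤP.*-assoc (+ 2) (+ suc (k ℕ.+ k)) (+ central k) ⟨
      + 2 * + suc (k ℕ.+ k) * + central k         ∎
      where open ≡-Reasoning

    4^k*mCk : ℕ → ℤ
    4^k*mCk k = (+ 4) ℤ.^ k * + (m C k)

    4^k*mCk-rec : ∀ k → + suc k * 4^k*mCk (suc k) ≈ - (+ 2 * + suc (k ℕ.+ k)) * 4^k*mCk k
    4^k*mCk-rec k = begin
      + suc k * (+ 4 * F * B)                         ≡⟨ regroup (+ suc k) F B ⟩
      + 2 * F * (+ 2 * (+ suc k * B))                 ≡⟨ cong (λ z → + 2 * F * (+ 2 * z)) ([1+k]*nC[1+k]≡[n-k]*nCk m k) ⟩
      + 2 * F * (+ 2 * ((+ m - + k) * A))             ≡⟨ cong (+ 2 * F *_) (ℤP.*-assoc (+ 2) (+ m - + k) A) ⟨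
      + 2 * F * (+ 2 * (+ m - + k) * A)               ≈⟨ *-congˡ (+ 2 * F) (*-congʳ A (2[m-k]≈-[2k+1] k)) ⟩
      + 2 * F * (- + suc (k ℕ.+ k) * A)               ≡⟨ regroup′ F A (+ k) ⟩
      - (+ 2 * + suc (k ℕ.+ k)) * (F * A)             ∎
      where
      open ≈-Reasoning
      F = (+ 4) ℤ.^ k
      A = + (m C k)
      B = + (m C suc k)
      regroup : ∀ K F B → K * (+ 4 * F * B) ≡ + 2 * F * (+ 2 * (K * B))
      regroup = ℤSolver.solve-∀
      regroup′ : ∀ F A k → + 2 * F * (- (+ 1 + (k + k)) * A) ≡ - (+ 2 * (+ 1 + (k + k))) * (F * A)
      regroup′ = ℤSolver.solve-∀

    central²≈[4^k*mCk]² : ∀ k → k < p → + central k * + central k ≈ 4^k*mCk k * 4^k*mCk k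
    central²≈[4^k*mCk]² = squares-≈ (λ k → + central k) 4^k*mCk (λ k → + 2 * + suc (k ℕ.+ k)) refl central-rec 4^k*mCk-rec

    -- The residue modulo p of a k = central k ² / 16ᵏ.
    â : ℕ → ℤ
    â k = + central k * + central k * 16⁻¹ ℤ.^ k

    â≈mCk² : ∀ k → k < p → â k ≈ + (m C k) * + (m C k)
    â≈mCk² k k<p = begin
      + central k * + central k * W                  ≈⟨ *-congʳ W (central²≈[4^k*mCk]² k k<p) ⟩
      (F * M) * (F * M) * W                          ≡⟨ regroup F M W ⟩
      (F * F) * W * (M * M)                          ≡⟨ cong (λ z → z * W * (M * M)) (^-distribʳ-* (+ 4) (+ 4) k) ⟨
      (+ 16) ℤ.^ k * W * (M * M)                     ≡⟨ cong (_* (M * M)) (^-distribʳ-* (+ 16) 16⁻¹ k) ⟨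
      (+ 16 * 16⁻¹) ℤ.^ k * (M * M)                  ≈⟨ *-congʳ (M * M) (^-cong k 16*16⁻¹≈1) ⟩
      (+ 1) ℤ.^ k * (M * M)                          ≡⟨ cong (_* (M * M)) (ℤP.^-zeroˡ k) ⟩
      + 1 * (M * M)                                  ≡⟨ ℤP.*-identityˡ (M * M) ⟩
      M * M                                          ∎
      where
      open ≈-Reasoning
      F = (+ 4) ℤ.^ k
      M = + (m C k)
      W = 16⁻¹ ℤ.^ k
      regroup : ∀ F M W → (F * M) * (F * M) * W ≡ (F * F) * W * (M * M)
      regroup = ℤSolver.solve-∀

    ∑[k<p]mCk²≡[2m]Cm : ∑[ k < p ] (+ (m C k) * + (m C k)) ≡ + ((m ℕ.+ m) C m)
    ∑[k<p]mCk²≡[2m]Cm = begin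
      ∑[ k < suc m ℕ.+ m ] (M k * M k)                                     ≡⟨ ∑-split (suc m) m (λ k → M k * M k) ⟩
      ∑[ k < suc m ] (M k * M k) + ∑[ i < m ] (M (suc m ℕ.+ i) * M (suc m ℕ.+ i))
        ≡⟨ cong₂ _+_ (∑-cong (suc m) λ k k≤m → cong (M k *_) (symmetric k≤m)) (trans (∑-cong m λ i _ → vanish i) (∑-zero m)) ⟩
      ∑[ k < suc m ] (M k * + (m C (m ℕ.∸ k))) + + 0                     ≡⟨ ℤP.+-identityʳ _ ⟩
      ∑[ k < suc m ] (M k * + (m C (m ℕ.∸ k)))                             ≡⟨ vandermonde m m m ⟩
      + ((m ℕ.+ m) C m)                                                   ∎
      where
      open ≡-Reasoning
      M : ℕ → ℤ
      M k = + (m C k)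
      symmetric : ∀ {k} → k < suc m → M k ≡ + (m C (m ℕ.∸ k))
      symmetric k≤m = cong +_ (nCk≡nC[n∸k] (ℕP.≤-pred k≤m))
      vanish : ∀ i → M (suc m ℕ.+ i) * M (suc m ℕ.+ i) ≡ + 0
      vanish i = trans (cong (_* M (suc m ℕ.+ i)) (cong +_ (k>n⇒nCk≡0 (s≤s (ℕP.m≤m+n m i))))) (ℤP.*-zeroˡ (M (suc m ℕ.+ i)))

    ∑[k<p]â≈[-1]^m : ∑< p â ≈ -1ℤ ℤ.^ m
    ∑[k<p]â≈[-1]^m = begin
      ∑< p â                                    ≈⟨ ∑-cong-≈ p â≈mCk² ⟩
      ∑[ k < p ] (+ (m C k) * + (m C k))        ≡⟨ ∑[k<p]mCk²≡[2m]Cm ⟩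
      + ((m ℕ.+ m) C m)                         ≈⟨ [p-1]Ck≈[-1]^k m (s≤s (ℕP.m≤m+n m m)) ⟩
      -1ℤ ℤ.^ m                                 ∎
      where open ≈-Reasoning

    â-multiplicative : ∀ j {i} → i < p → â (i ℕ.+ p ℕ.* j) ≈ â i * â j
    â-multiplicative j {i} i<p = begin
      C[i+pj] * C[i+pj] * 16⁻¹ ℤ.^ (i ℕ.+ p ℕ.* j)
        ≡⟨ cong (C[i+pj] * C[i+pj] *_) (trans (ℤP.^-distribˡ-+-* 16⁻¹ i (p ℕ.* j)) (cong (Wi *_) (sym (ℤP.^-*-assoc 16⁻¹ p j)))) ⟩
      C[i+pj] * C[i+pj] * (Wi * (16⁻¹ ℤ.^ p) ℤ.^ j)
        ≈⟨ *-cong (*-cong (central-lucas j i<p) (central-lucas j i<p)) (*-congˡ Wi (^-cong j 16⁻¹^p≈16⁻¹)) ⟩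
      (Ci * Cj) * (Ci * Cj) * (Wi * Wj)
        ≡⟨ regroup Ci Cj Wi Wj ⟩
      (Ci * Ci * Wi) * (Cj * Cj * Wj)
        ∎
      where
      open ≈-Reasoning
      C[i+pj] = + central (i ℕ.+ p ℕ.* j)
      Ci = + central i
      Cj = + central j
      Wi = 16⁻¹ ℤ.^ i
      Wj = 16⁻¹ ℤ.^ j
      regroup : ∀ a b x y → (a * b) * (a * b) * (x * y) ≡ (a * a * x) * (b * b * y)
      regroup = ℤSolver.solve-∀

    ∑[k<p^r]â≈[-1]^[mr] : ∀ r → ∑< (p ^ r) â ≈ (-1ℤ ℤ.^ m) ℤ.^ r
    ∑[k<p^r]â≈[-1]^[mr] zero    = ≈-refl
    ∑[k<p^r]â≈[-1]^[mr] (suc r) = begin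
      ∑< (p ℕ.* p ^ r) â                      ≈⟨ ∑-multiplicative â-multiplicative (p ^ r) ⟩
      ∑< p â * ∑< (p ^ r) â                   ≈⟨ *-cong ∑[k<p]â≈[-1]^m (∑[k<p^r]â≈[-1]^[mr] r) ⟩
      (-1ℤ ℤ.^ m) * (-1ℤ ℤ.^ m) ℤ.^ r         ∎
      where open ≈-Reasoning

    16⁻¹^[p^r]≈16⁻¹ : ∀ r → 16⁻¹ ℤ.^ (p ^ r) ≈ 16⁻¹
    16⁻¹^[p^r]≈16⁻¹ zero    = ≡⇒≈ (ℤP.^-identityʳ 16⁻¹)
    16⁻¹^[p^r]≈16⁻¹ (suc r) = begin
      16⁻¹ ℤ.^ (p ℕ.* p ^ r)          ≡⟨ ℤP.^-*-assoc 16⁻¹ p (p ^ r) ⟨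
      (16⁻¹ ℤ.^ p) ℤ.^ (p ^ r)        ≈⟨ ^-cong (p ^ r) 16⁻¹^p≈16⁻¹ ⟩
      16⁻¹ ℤ.^ (p ^ r)                ≈⟨ 16⁻¹^[p^r]≈16⁻¹ r ⟩
      16⁻¹                            ∎
      where open ≈-Reasoning

    16⁻¹^n*16^n≈1 : ∀ n → 16⁻¹ ℤ.^ n * (+ 16) ℤ.^ n ≈ + 1
    16⁻¹^n*16^n≈1 n = begin
      16⁻¹ ℤ.^ n * (+ 16) ℤ.^ n      ≡⟨ ℤP.*-comm (16⁻¹ ℤ.^ n) ((+ 16) ℤ.^ n) ⟩
      (+ 16) ℤ.^ n * 16⁻¹ ℤ.^ n      ≡⟨ ^-distribʳ-* (+ 16) 16⁻¹ n ⟨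
      (+ 16 * 16⁻¹) ℤ.^ n            ≈⟨ ^-cong n 16*16⁻¹≈1 ⟩
      (+ 1) ℤ.^ n                    ≡⟨ ℤP.^-zeroˡ n ⟩
      + 1                            ∎
      where open ≈-Reasoning

    central²*16^[n-k]*16⁻¹^n≈â : ∀ {n k} → k ≤ n → + central k * + central k * (+ 16) ℤ.^ (n ℕ.∸ k) * 16⁻¹ ℤ.^ n ≈ â k
    central²*16^[n-k]*16⁻¹^n≈â {n} {k} k≤n = begin
      c * c * (+ 16) ℤ.^ (n ℕ.∸ k) * 16⁻¹ ℤ.^ n
        ≡⟨ cong (λ e → c * c * (+ 16) ℤ.^ (n ℕ.∸ k) * 16⁻¹ ℤ.^ e) (ℕP.m∸n+n≡m k≤n) ⟨
      c * c * (+ 16) ℤ.^ (n ℕ.∸ k) * 16⁻¹ ℤ.^ (n ℕ.∸ k ℕ.+ k)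
        ≡⟨ cong (_*_ (c * c * (+ 16) ℤ.^ (n ℕ.∸ k))) (ℤP.^-distribˡ-+-* 16⁻¹ (n ℕ.∸ k) k) ⟩
      c * c * (+ 16) ℤ.^ (n ℕ.∸ k) * (16⁻¹ ℤ.^ (n ℕ.∸ k) * 16⁻¹ ℤ.^ k)
        ≡⟨ regroup c ((+ 16) ℤ.^ (n ℕ.∸ k)) (16⁻¹ ℤ.^ (n ℕ.∸ k)) (16⁻¹ ℤ.^ k) ⟩
      â k * (16⁻¹ ℤ.^ (n ℕ.∸ k) * (+ 16) ℤ.^ (n ℕ.∸ k))
        ≈⟨ *-congˡ (â k) (16⁻¹^n*16^n≈1 (n ℕ.∸ k)) ⟩
      â k * + 1
        ≡⟨ ℤP.*-identityʳ (â k) ⟩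
      â k ∎
      where
      open ≈-Reasoning
      c = + central k
      regroup : ∀ c F G H → c * c * F * (G * H) ≡ c * c * H * (G * F)
      regroup = ℤSolver.solve-∀

    16⁻¹^[p^r]*4*central[p^r]²≈1 : ∀ r → 16⁻¹ ℤ.^ (p ^ r) * (+ 4 * + central (p ^ r) * + central (p ^ r)) ≈ + 1
    16⁻¹^[p^r]*4*central[p^r]²≈1 r = begin
      16⁻¹ ℤ.^ (p ^ r) * (+ 4 * + central (p ^ r) * + central (p ^ r))
        ≈⟨ *-cong (16⁻¹^[p^r]≈16⁻¹ r) (*-cong (*-congˡ (+ 4) (central[p^r]≈2 r)) (central[p^r]≈2 r)) ⟩
      16⁻¹ * + 16      ≡⟨ ℤP.*-comm 16⁻¹ (+ 16) ⟩
      + 16 * 16⁻¹      ≈⟨ 16*16⁻¹≈1 ⟩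
      + 1              ∎
      where open ≈-Reasoning

    Δ[p^r]≈0 : -1ℤ ℤ.^ m ≡ + 1 → ∀ r → Δ (p ^ r) ≈ + 0
    Δ[p^r]≈0 [-1]^m≡1 r = *-cancelˡ-≈ W ((+ 16) ℤ.^ n) (16⁻¹^n*16^n≈1 n) (begin
      W * (+ 4 * + central n * + central n - ∑< n t)       ≡⟨ distrib W (+ 4 * + central n * + central n) (∑< n t) ⟩
      W * (+ 4 * + central n * + central n) - ∑< n t * W   ≡⟨ cong (λ z → W * (+ 4 * + central n * + central n) - z) (∑-distribʳ-* n t W) ⟨
      W * (+ 4 * + central n * + central n) - ∑[ k < n ] (t k * W)
        ≈⟨ +-cong (16⁻¹^[p^r]*4*central[p^r]²≈1 r) (-‿cong (∑-cong-≈ n λ k k<n → central²*16^[n-k]*16⁻¹^n≈â (ℕP.<⇒≤ k<n))) ⟩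
      + 1 - ∑< n â                 ≈⟨ +-cong (≈-refl {+ 1}) (-‿cong (∑[k<p^r]â≈[-1]^[mr] r)) ⟩
      + 1 - (-1ℤ ℤ.^ m) ℤ.^ r      ≡⟨ cong (λ z → + 1 - z ℤ.^ r) [-1]^m≡1 ⟩
      + 1 - (+ 1) ℤ.^ r            ≡⟨ cong (λ z → + 1 - z) (ℤP.^-zeroˡ r) ⟩
      + 0                          ≡⟨ ℤP.*-zeroʳ W ⟨
      W * + 0                      ∎)
      where
      open ≈-Reasoning
      n = p ^ r
      W = 16⁻¹ ℤ.^ n
      t : ℕ → ℤ
      t k = + central k * + central k * (+ 16) ℤ.^ (n ℕ.∸ k)
      distrib : ∀ W A S → W * (A - S) ≡ W * A - S * W
      distrib = ℤSolver.solve-∀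

module Rationals where

  open import Data.Integer as ℤ using (ℤ; +_)
  import Data.Integer.Properties as ℤP
  import Data.Integer.Tactic.RingSolver as ℤSolver
  open import Data.Nat as ℕ using (ℕ; zero; suc; _<_; _≤_; _^_)
  open import Data.Nat.Divisibility as ℕD using (_∣_)
  open import Data.Nat.Primality using (Prime; euclidsLemma; prime⇒nonTrivial)
  import Data.Nat.Coprimality as Coprimality
  import Data.Nat.Properties as ℕP
  open import Data.Product using (_,_)
  open import Data.Rational as ℚ using (ℚ; mkℚ; _+_; _*_; _-_; _/_; ½; 0ℚ; 1ℚ; toℚᵘ; ↥_; ↧ₙ_)
  import Data.Rational.Properties as ℚP
  open import Data.Rational.Solver using (module +-*-Solver)
  open import Data.Rational.Unnormalised as ℚᵘ using (mkℚᵘ; *≡*)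
  import Data.Rational.Unnormalised.Properties as ℚᵘP
  open import Data.Sum using (inj₁; inj₂)
  open import Relation.Binary.PropositionalEquality
  open import Relation.Nullary using (¬_)
  open import Defs
  open Integers using (∑<; central; [1+k]*central[1+k]≡2[2k+1]*central[k]; pos-^; Δ)
  open Integers.ModuloPrime using (p^e∣m*n⇒p^e∣m)

  fromℤ : ℤ → ℚ
  fromℤ i = i / 1

  fromℕ : ℕ → ℚ
  fromℕ n = fromℤ (+ n)

  private
    toℚᵘ-fromℤ : ∀ i → toℚᵘ (fromℤ i) ℚᵘ.≃ mkℚᵘ i 0
    toℚᵘ-fromℤ i = ℚP.toℚᵘ-fromℚᵘ (mkℚᵘ i 0)

  fromℤ-+ : ∀ i j → fromℤ (i ℤ.+ j) ≡ fromℤ i + fromℤ j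
  fromℤ-+ i j = ℚP.toℚᵘ-injective (begin
    toℚᵘ (fromℤ (i ℤ.+ j))                ≈⟨ toℚᵘ-fromℤ (i ℤ.+ j) ⟩
    mkℚᵘ (i ℤ.+ j) 0                      ≈⟨ *≡* ([i+j]*1≡[i*1+j*1]*1 i j) ⟩
    mkℚᵘ i 0 ℚᵘ.+ mkℚᵘ j 0                ≈⟨ ℚᵘP.+-cong (toℚᵘ-fromℤ i) (toℚᵘ-fromℤ j) ⟨
    toℚᵘ (fromℤ i) ℚᵘ.+ toℚᵘ (fromℤ j)    ≈⟨ ℚP.toℚᵘ-homo-+ (fromℤ i) (fromℤ j) ⟨
    toℚᵘ (fromℤ i + fromℤ j)              ∎)
    where
    open ℚᵘP.≃-Reasoning
    [i+j]*1≡[i*1+j*1]*1 : ∀ i j → (i ℤ.+ j) ℤ.* + 1 ≡ (i ℤ.* + 1 ℤ.+ j ℤ.* + 1) ℤ.* + 1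
    [i+j]*1≡[i*1+j*1]*1 = ℤSolver.solve-∀

  fromℤ-* : ∀ i j → fromℤ (i ℤ.* j) ≡ fromℤ i * fromℤ j
  fromℤ-* i j = ℚP.toℚᵘ-injective (begin
    toℚᵘ (fromℤ (i ℤ.* j))                ≈⟨ toℚᵘ-fromℤ (i ℤ.* j) ⟩
    mkℚᵘ i 0 ℚᵘ.* mkℚᵘ j 0                ≈⟨ ℚᵘP.*-cong (toℚᵘ-fromℤ i) (toℚᵘ-fromℤ j) ⟨
    toℚᵘ (fromℤ i) ℚᵘ.* toℚᵘ (fromℤ j)    ≈⟨ ℚP.toℚᵘ-homo-* (fromℤ i) (fromℤ j) ⟨
    toℚᵘ (fromℤ i * fromℤ j)              ∎)
    where open ℚᵘP.≃-Reasoning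

  fromℤ-neg : ∀ i → fromℤ (ℤ.- i) ≡ ℚ.- fromℤ i
  fromℤ-neg i = ℚP.toℚᵘ-injective (begin
    toℚᵘ (fromℤ (ℤ.- i))     ≈⟨ toℚᵘ-fromℤ (ℤ.- i) ⟩
    ℚᵘ.- mkℚᵘ i 0            ≈⟨ ℚᵘP.-‿cong (toℚᵘ-fromℤ i) ⟨
    ℚᵘ.- toℚᵘ (fromℤ i)      ≈⟨ ℚP.toℚᵘ-homo‿- (fromℤ i) ⟨
    toℚᵘ (ℚ.- fromℤ i)       ∎)
    where open ℚᵘP.≃-Reasoning

  /-*-cancel : ∀ i d → i / suc d * fromℕ (suc d) ≡ fromℤ i
  /-*-cancel i d = ℚP.toℚᵘ-injective (begin
    toℚᵘ (i / suc d * fromℕ (suc d))                ≈⟨ ℚP.toℚᵘ-homo-* (i / suc d) (fromℕ (suc d)) ⟩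
    toℚᵘ (i / suc d) ℚᵘ.* toℚᵘ (fromℕ (suc d))      ≈⟨ ℚᵘP.*-cong (ℚP.toℚᵘ-fromℚᵘ (mkℚᵘ i d)) (toℚᵘ-fromℤ (+ suc d)) ⟩
    mkℚᵘ i d ℚᵘ.* mkℚᵘ (+ suc d) 0                  ≈⟨ *≡* ([i*D]*1≡i*[D*1] i (+ suc d)) ⟩
    mkℚᵘ i 0                                        ≈⟨ toℚᵘ-fromℤ i ⟨
    toℚᵘ (fromℤ i)                                  ∎)
    where
    open ℚᵘP.≃-Reasoning
    [i*D]*1≡i*[D*1] : ∀ i D → (i ℤ.* D) ℤ.* + 1 ≡ i ℤ.* (D ℤ.* + 1)
    [i*D]*1≡i*[D*1] = ℤSolver.solve-∀

  fromℕ-+ : ∀ m n → fromℕ (m ℕ.+ n) ≡ fromℕ m + fromℕ n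
  fromℕ-+ m n = trans (cong fromℤ (ℤP.pos-+ m n)) (fromℤ-+ (+ m) (+ n))

  fromℕ-* : ∀ m n → fromℕ (m ℕ.* n) ≡ fromℕ m * fromℕ n
  fromℕ-* m n = trans (cong fromℤ (ℤP.pos-* m n)) (fromℤ-* (+ m) (+ n))

  fromℤ-∑ : ∀ n (f : ℕ → ℤ) → fromℤ (∑< n f) ≡ sumTo n (λ k → fromℤ (f k))
  fromℤ-∑ zero    f = refl
  fromℤ-∑ (suc n) f = trans (fromℤ-+ (∑< n f) (f n)) (cong (_+ fromℤ (f n)) (fromℤ-∑ n f))

  sumTo-cong : ∀ n {f g : ℕ → ℚ} → (∀ k → k < n → f k ≡ g k) → sumTo n f ≡ sumTo n g
  sumTo-cong zero    f≡g = refl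
  sumTo-cong (suc n) f≡g = cong₂ _+_ (sumTo-cong n λ k k<n → f≡g k (ℕP.m<n⇒m<1+n k<n)) (f≡g n ℕP.≤-refl)

  sumTo-distribʳ-* : ∀ n (f : ℕ → ℚ) x → sumTo n f * x ≡ sumTo n (λ k → f k * x)
  sumTo-distribʳ-* zero    f x = ℚP.*-zeroˡ x
  sumTo-distribʳ-* (suc n) f x = trans (ℚP.*-distribʳ-+ x (sumTo n f) (f n)) (cong (_+ f n * x) (sumTo-distribʳ-* n f x))

  ½-pochhammer : ∀ k → poch ½ k * invFact k * fromℕ (4 ^ k) ≡ fromℕ (central k)
  ½-pochhammer zero    = refl
  ½-pochhammer (suc k) = begin
    poch ½ k * (½ + K) * (invFact k * u) * fromℕ (4 ℕ.* 4 ^ k)   ≡⟨ cong (poch ½ k * (½ + K) * (invFact k * u) *_) (fromℕ-* 4 (4 ^ k)) ⟩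
    poch ½ k * (½ + K) * (invFact k * u) * (fromℕ 4 * fromℕ (4 ^ k))
      ≡⟨ solve 6 (λ P K I u F G → P :* (con ½ :+ K) :* (I :* u) :* (F :* G) := (P :* I :* G) :* ((con ½ :+ K) :* F) :* u) refl
           (poch ½ k) K (invFact k) u (fromℕ 4) (fromℕ (4 ^ k)) ⟩
    poch ½ k * invFact k * fromℕ (4 ^ k) * ((½ + K) * fromℕ 4) * u   ≡⟨ cong (λ z → z * ((½ + K) * fromℕ 4) * u) (½-pochhammer k) ⟩
    C * ((½ + K) * fromℕ 4) * u
      ≡⟨ solve 3 (λ C K u → C :* ((con ½ :+ K) :* con (fromℕ 4)) :* u := con (fromℕ 2) :* ((con 1ℚ :+ (K :+ K)) :* C) :* u) refl C K u ⟩
    fromℕ 2 * ((1ℚ + (K + K)) * C) * u                                ≡⟨ cong (_* u) recurrence ⟩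
    fromℕ (suc k) * C′ * u                                            ≡⟨ solve 3 (λ K′ C′ u → K′ :* C′ :* u := C′ :* (u :* K′)) refl (fromℕ (suc k)) C′ u ⟩
    C′ * (u * fromℕ (suc k))                                          ≡⟨ cong (C′ *_) (/-*-cancel (+ 1) k) ⟩
    C′ * 1ℚ                                                           ≡⟨ ℚP.*-identityʳ C′ ⟩
    C′                                                                ∎
    where
    open ≡-Reasoning
    open +-*-Solver
    K = fromℕ k
    u = + 1 / suc k
    C = fromℕ (central k)
    C′ = fromℕ (central (suc k))
    recurrence : fromℕ 2 * ((1ℚ + (K + K)) * C) ≡ fromℕ (suc k) * C′
    recurrence = begin
      fromℕ 2 * ((1ℚ + (K + K)) * C)              ≡⟨ cong (λ z → fromℕ 2 * (z * C)) (trans (fromℕ-+ 1 (k ℕ.+ k)) (cong (_+_ 1ℚ) (fromℕ-+ k k))) ⟨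
      fromℕ 2 * (fromℕ (suc (k ℕ.+ k)) * C)       ≡⟨ cong (fromℕ 2 *_) (fromℕ-* (suc (k ℕ.+ k)) (central k)) ⟨
      fromℕ 2 * fromℕ (suc (k ℕ.+ k) ℕ.* central k) ≡⟨ fromℕ-* 2 (suc (k ℕ.+ k) ℕ.* central k) ⟨
      fromℕ (2 ℕ.* (suc (k ℕ.+ k) ℕ.* central k)) ≡⟨ cong fromℕ ([1+k]*central[1+k]≡2[2k+1]*central[k] k) ⟨
      fromℕ (suc k ℕ.* central (suc k))           ≡⟨ fromℕ-* (suc k) (central (suc k)) ⟩
      fromℕ (suc k) * C′                          ∎

  a : ℕ → ℚ
  a k = poch ½ k * poch ½ k * (invFact k * invFact k)

  a-rec : ∀ k → fromℕ (suc k) * fromℕ (suc k) * a (suc k) ≡ (½ + fromℕ k) * (½ + fromℕ k) * a k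
  a-rec k = begin
    fromℕ (suc k) * fromℕ (suc k) * a (suc k)
      ≡⟨ solve 5 (λ K′ P K I u → K′ :* K′ :* (P :* (con ½ :+ K) :* (P :* (con ½ :+ K)) :* (I :* u :* (I :* u)))
                             := (con ½ :+ K) :* (con ½ :+ K) :* (P :* P :* (I :* I)) :* ((u :* K′) :* (u :* K′))) refl
           (fromℕ (suc k)) (poch ½ k) (fromℕ k) (invFact k) u ⟩
    (½ + fromℕ k) * (½ + fromℕ k) * a k * ((u * fromℕ (suc k)) * (u * fromℕ (suc k)))
      ≡⟨ cong (λ z → (½ + fromℕ k) * (½ + fromℕ k) * a k * (z * z)) (/-*-cancel (+ 1) k) ⟩
    (½ + fromℕ k) * (½ + fromℕ k) * a k * (1ℚ * 1ℚ)
      ≡⟨ ℚP.*-identityʳ _ ⟩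
    (½ + fromℕ k) * (½ + fromℕ k) * a k ∎
    where
    open ≡-Reasoning
    open +-*-Solver
    u = + 1 / suc k

  ¼ : ℚ
  ¼ = + 1 / 4

  -- (k+1)² f (k+1) − k² f k = (k + ¼) f k.
  telescope : ∀ (f : ℕ → ℚ) → (∀ k → fromℕ (suc k) * fromℕ (suc k) * f (suc k) ≡ (½ + fromℕ k) * (½ + fromℕ k) * f k) →
              ∀ Q n → sumTo n (λ k → (fromℕ k - Q) * f k) ≡ fromℕ n * fromℕ n * f n - (Q + ¼) * sumTo n f
  telescope f f-rec Q zero = solve 2 (λ F Q → con 0ℚ := con 0ℚ :* con 0ℚ :* F :- (Q :+ con ¼) :* con 0ℚ) refl (f 0) Q
    where open +-*-Solver
  telescope f f-rec Q (suc n) = begin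
    sumTo n (λ k → (fromℕ k - Q) * f k) + (N - Q) * f n         ≡⟨ cong (_+ (N - Q) * f n) (telescope f f-rec Q n) ⟩
    N * N * f n - (Q + ¼) * S + (N - Q) * f n                   ≡⟨ solve 4 (λ N F Q S → N :* N :* F :- (Q :+ con ¼) :* S :+ (N :- Q) :* F
                                                                          := (con ½ :+ N) :* (con ½ :+ N) :* F :- (Q :+ con ¼) :* (S :+ F)) refl N (f n) Q S ⟩
    (½ + N) * (½ + N) * f n - (Q + ¼) * (S + f n)              ≡⟨ cong (_- (Q + ¼) * (S + f n)) (f-rec n) ⟨
    fromℕ (suc n) * fromℕ (suc n) * f (suc n) - (Q + ¼) * (S + f n) ∎
    where
    open ≡-Reasoning
    open +-*-Solver
    N = fromℕ n
    S = sumTo n f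

  fromℤ-− : ∀ i j → fromℤ (i ℤ.- j) ≡ fromℤ i - fromℤ j
  fromℤ-− i j = trans (fromℤ-+ i (ℤ.- j)) (cong (_+_ (fromℤ i)) (fromℤ-neg j))

  a*16^k≡central² : ∀ k → a k * fromℕ (16 ^ k) ≡ fromℕ (central k ℕ.* central k)
  a*16^k≡central² k = begin
    a k * fromℕ (16 ^ k)                        ≡⟨ cong (λ z → a k * fromℕ z) 16^k≡4^k*4^k ⟩
    a k * fromℕ (4 ^ k ℕ.* 4 ^ k)               ≡⟨ cong (a k *_) (fromℕ-* (4 ^ k) (4 ^ k)) ⟩
    a k * (F * F)                               ≡⟨ solve 3 (λ P I F → P :* P :* (I :* I) :* (F :* F) := (P :* I :* F) :* (P :* I :* F)) refl (poch ½ k) (invFact k) F ⟩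
    (poch ½ k * invFact k * F) * (poch ½ k * invFact k * F) ≡⟨ cong (λ z → z * z) (½-pochhammer k) ⟩
    fromℕ (central k) * fromℕ (central k)       ≡⟨ fromℕ-* (central k) (central k) ⟨
    fromℕ (central k ℕ.* central k)               ∎
    where
    open ≡-Reasoning
    open +-*-Solver
    F = fromℕ (4 ^ k)
    16^k≡4^k*4^k : 16 ^ k ≡ 4 ^ k ℕ.* 4 ^ k
    16^k≡4^k*4^k = trans (ℕP.^-*-assoc 4 2 k) (trans (cong (λ e → 4 ^ (k ℕ.+ e)) (ℕP.+-identityʳ k)) (ℕP.^-distribˡ-+-* 4 k k))

  [[N∸1]/4+¼]*4≡N : ∀ {N} → 1 ≤ N → (+ (N ℕ.∸ 1) / 4 + ¼) * fromℕ 4 ≡ fromℕ N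
  [[N∸1]/4+¼]*4≡N {N} 1≤N = begin
    (+ (N ℕ.∸ 1) / 4 + ¼) * fromℕ 4                 ≡⟨ ℚP.*-distribʳ-+ (fromℕ 4) (+ (N ℕ.∸ 1) / 4) ¼ ⟩
    + (N ℕ.∸ 1) / 4 * fromℕ 4 + ¼ * fromℕ 4         ≡⟨ cong (_+ ¼ * fromℕ 4) (/-*-cancel (+ (N ℕ.∸ 1)) 3) ⟩
    fromℕ (N ℕ.∸ 1) + fromℕ 1                       ≡⟨ fromℕ-+ (N ℕ.∸ 1) 1 ⟨
    fromℕ (N ℕ.∸ 1 ℕ.+ 1)                           ≡⟨ cong fromℕ (ℕP.m∸n+n≡m 1≤N) ⟩
    fromℕ N                                         ∎
    where open ≡-Reasoning

  ∑a*16^n≡∑central²*16^[n-k] : ∀ n → sumTo n a * fromℕ (16 ^ n) ≡ fromℤ (∑[ k < n ] (+ central k ℤ.* + central k ℤ.* (+ 16) ℤ.^ (n ℕ.∸ k)))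
  ∑a*16^n≡∑central²*16^[n-k] n = begin
    sumTo n a * fromℕ (16 ^ n)                        ≡⟨ sumTo-distribʳ-* n a (fromℕ (16 ^ n)) ⟩
    sumTo n (λ k → a k * fromℕ (16 ^ n))              ≡⟨ sumTo-cong n term ⟩
    sumTo n (λ k → fromℤ (t k))                       ≡⟨ fromℤ-∑ n t ⟨
    fromℤ (∑< n t)                                    ∎
    where
    open ≡-Reasoning
    t : ℕ → ℤ
    t k = + central k ℤ.* + central k ℤ.* (+ 16) ℤ.^ (n ℕ.∸ k)
    term : ∀ k → k < n → a k * fromℕ (16 ^ n) ≡ fromℤ (t k)
    term k k<n = begin
      a k * fromℕ (16 ^ n)                                ≡⟨ cong (λ e → a k * fromℕ (16 ^ e)) (ℕP.m+[n∸m]≡n (ℕP.<⇒≤ k<n)) ⟨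
      a k * fromℕ (16 ^ (k ℕ.+ (n ℕ.∸ k)))                 ≡⟨ cong (λ z → a k * fromℕ z) (ℕP.^-distribˡ-+-* 16 k (n ℕ.∸ k)) ⟩
      a k * fromℕ (16 ^ k ℕ.* 16 ^ (n ℕ.∸ k))              ≡⟨ cong (a k *_) (fromℕ-* (16 ^ k) (16 ^ (n ℕ.∸ k))) ⟩
      a k * (fromℕ (16 ^ k) * fromℕ (16 ^ (n ℕ.∸ k)))      ≡⟨ ℚP.*-assoc (a k) _ _ ⟨
      a k * fromℕ (16 ^ k) * fromℕ (16 ^ (n ℕ.∸ k))        ≡⟨ cong (_* fromℕ (16 ^ (n ℕ.∸ k))) (a*16^k≡central² k) ⟩
      fromℕ (central k ℕ.* central k) * fromℕ (16 ^ (n ℕ.∸ k)) ≡⟨ fromℕ-* (central k ℕ.* central k) (16 ^ (n ℕ.∸ k)) ⟨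
      fromℕ (central k ℕ.* central k ℕ.* 16 ^ (n ℕ.∸ k))   ≡⟨ cong fromℤ (trans (ℤP.pos-* (central k ℕ.* central k) _) (cong₂ ℤ._*_ (ℤP.pos-* (central k) (central k)) (pos-^ 16 (n ℕ.∸ k)))) ⟩
      fromℤ (t k)                                         ∎

  4*16^n*∑≡n²Δ : ∀ n → 1 ≤ n →
    sumTo n (λ k → (fromℕ k - + (n ℕ.* n ℕ.∸ 1) / 4) * a k) * fromℕ (4 ℕ.* 16 ^ n) ≡ fromℤ (+ (n ℕ.* n) ℤ.* Δ n)
  4*16^n*∑≡n²Δ n 1≤n = begin
    sumTo n (λ k → (fromℕ k - Q) * a k) * fromℕ (4 ℕ.* 16 ^ n)
      ≡⟨ cong₂ _*_ (telescope a a-rec Q n) (fromℕ-* 4 (16 ^ n)) ⟩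
    (N * N * a n - (Q + ¼) * S) * (fromℕ 4 * G)
      ≡⟨ solve 6 (λ N A Q S F G → (N :* N :* A :- (Q :+ con ¼) :* S) :* (F :* G) := N :* N :* (F :* (A :* G)) :- ((Q :+ con ¼) :* F) :* (S :* G)) refl N (a n) Q S (fromℕ 4) G ⟩
    N * N * (fromℕ 4 * (a n * G)) - ((Q + ¼) * fromℕ 4) * (S * G)
      ≡⟨ cong₂ (λ x y → N * N * (fromℕ 4 * x) - y * (S * G)) (a*16^k≡central² n) ([[N∸1]/4+¼]*4≡N (ℕP.*-mono-≤ 1≤n 1≤n)) ⟩
    N * N * (fromℕ 4 * fromℕ (central n ℕ.* central n)) - fromℕ (n ℕ.* n) * (S * G)
      ≡⟨ cong₂ (λ x y → x * (fromℕ 4 * fromℕ (central n ℕ.* central n)) - fromℕ (n ℕ.* n) * y) (fromℕ-* n n) (sym (∑a*16^n≡∑central²*16^[n-k] n)) ⟨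
    fromℕ (n ℕ.* n) * (fromℕ 4 * fromℕ (central n ℕ.* central n)) - fromℕ (n ℕ.* n) * fromℤ Σ
      ≡⟨ solve 3 (λ M X Y → M :* X :- M :* Y := M :* (X :- Y)) refl (fromℕ (n ℕ.* n)) (fromℕ 4 * fromℕ (central n ℕ.* central n)) (fromℤ Σ) ⟩
    fromℕ (n ℕ.* n) * (fromℕ 4 * fromℕ (central n ℕ.* central n) - fromℤ Σ)
      ≡⟨ cong (λ x → fromℕ (n ℕ.* n) * (x - fromℤ Σ)) (trans (sym (fromℕ-* 4 (central n ℕ.* central n))) (cong fromℤ 4c²)) ⟩
    fromℕ (n ℕ.* n) * (fromℤ (+ 4 ℤ.* + central n ℤ.* + central n) - fromℤ Σ)
      ≡⟨ cong (fromℕ (n ℕ.* n) *_) (fromℤ-− (+ 4 ℤ.* + central n ℤ.* + central n) Σ) ⟨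
    fromℕ (n ℕ.* n) * fromℤ (Δ n)
      ≡⟨ fromℤ-* (+ (n ℕ.* n)) (Δ n) ⟨
    fromℤ (+ (n ℕ.* n) ℤ.* Δ n)
      ∎
    where
    open ≡-Reasoning
    open +-*-Solver
    Q = + (n ℕ.* n ℕ.∸ 1) / 4
    N = fromℕ n
    S = sumTo n a
    G = fromℕ (16 ^ n)
    Σ = ∑[ k < n ] (+ central k ℤ.* + central k ℤ.* (+ 16) ℤ.^ (n ℕ.∸ k))
    4c² : + (4 ℕ.* (central n ℕ.* central n)) ≡ + 4 ℤ.* + central n ℤ.* + central n
    4c² = begin
      + (4 ℕ.* (central n ℕ.* central n))              ≡⟨ ℤP.pos-* 4 (central n ℕ.* central n) ⟩
      + 4 ℤ.* + (central n ℕ.* central n)              ≡⟨ cong (ℤ._*_ (+ 4)) (ℤP.pos-* (central n) (central n)) ⟩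
      + 4 ℤ.* (+ central n ℤ.* + central n)            ≡⟨ ℤP.*-assoc (+ 4) (+ central n) (+ central n) ⟨
      + 4 ℤ.* + central n ℤ.* + central n              ∎

  cross-multiply : ∀ (x : ℚ) D N → x * fromℕ D ≡ fromℤ N → ℤ.∣ ↥ x ∣ ℕ.* D ≡ ℤ.∣ N ∣ ℕ.* ↧ₙ x
  cross-multiply x@(mkℚ n d _) D N xD≡N with xD≃N
    where
    open ℚᵘP.≃-Reasoning
    xD≃N : mkℚᵘ n d ℚᵘ.* mkℚᵘ (+ D) 0 ℚᵘ.≃ mkℚᵘ N 0
    xD≃N = begin
      mkℚᵘ n d ℚᵘ.* mkℚᵘ (+ D) 0        ≈⟨ ℚᵘP.*-congˡ {mkℚᵘ n d} (ℚP.toℚᵘ-fromℚᵘ (mkℚᵘ (+ D) 0)) ⟨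
      toℚᵘ x ℚᵘ.* toℚᵘ (fromℕ D)         ≈⟨ ℚP.toℚᵘ-homo-* x (fromℕ D) ⟨
      toℚᵘ (x * fromℕ D)                 ≈⟨ ℚP.toℚᵘ-cong xD≡N ⟩
      toℚᵘ (fromℤ N)                     ≈⟨ ℚP.toℚᵘ-fromℚᵘ (mkℚᵘ N 0) ⟩
      mkℚᵘ N 0                           ∎
  ... | *≡* eq = begin
    ℤ.∣ n ∣ ℕ.* D                      ≡⟨ ℤP.abs-* n (+ D) ⟨
    ℤ.∣ n ℤ.* + D ∣                    ≡⟨ cong ℤ.∣_∣ (ℤP.*-identityʳ (n ℤ.* + D)) ⟨
    ℤ.∣ n ℤ.* + D ℤ.* + 1 ∣            ≡⟨ cong ℤ.∣_∣ eq ⟩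
    ℤ.∣ N ℤ.* + (suc d ℕ.* 1) ∣        ≡⟨ ℤP.abs-* N (+ (suc d ℕ.* 1)) ⟩
    ℤ.∣ N ∣ ℕ.* (suc d ℕ.* 1)          ≡⟨ cong (ℤ.∣ N ∣ ℕ.*_) (ℕP.*-identityʳ (suc d)) ⟩
    ℤ.∣ N ∣ ℕ.* suc d                  ∎
    where open ≡-Reasoning

  module _ {p} (prime : Prime p) where

    ≡0modℤp-intro : ∀ e {D} (x : ℚ) (N : ℤ) → ¬ p ∣ D → x * fromℕ D ≡ fromℤ N → p ^ e ∣ ℤ.∣ N ∣ → ≡0modℤp p e x
    ≡0modℤp-intro e {D} x@(mkℚ n d c) N p∤D xD≡N p^e∣N = p∤den , p^e∣num
      where
      nD≡N[1+d] : ℤ.∣ n ∣ ℕ.* D ≡ ℤ.∣ N ∣ ℕ.* suc d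
      nD≡N[1+d] = cross-multiply x D N xD≡N
      p∤den : ¬ p ∣ suc d
      p∤den p∣den with euclidsLemma ℤ.∣ n ∣ D prime (subst (p ∣_) (sym nD≡N[1+d]) (ℕD.∣n⇒∣m*n ℤ.∣ N ∣ p∣den))
      ... | inj₂ p∣D   = p∤D p∣D
      ... | inj₁ p∣num = ℕP.<⇒≢ (ℕ.nonTrivial⇒n>1 p {{prime⇒nonTrivial prime}}) (sym (Coprimality.recompute c (p∣num , p∣den)))
      p^e∣num : p ^ e ∣ ℤ.∣ n ∣
      p^e∣num = p^e∣m*n⇒p^e∣m prime p∤D e ℤ.∣ n ∣ (subst (p ^ e ∣_) (sym nD≡N[1+d]) (ℕD.∣m⇒∣m*n (suc d) p^e∣N))

open import Defs
open import Data.Nat as ℕ using (ℕ; suc; s≤s; z≤n; _≥_; _^_; _∸_; _%_)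
open import Data.Nat.DivMod using (m≡m%n+[m/n]*n)
open import Data.Nat.Divisibility as ℕD using (_∣_)
open import Data.Nat.Primality using (Prime)
import Data.Nat.Properties as ℕP
import Data.Nat.Tactic.RingSolver as ℕSolver
open import Data.Integer as ℤ using ()
import Data.Integer.Properties as ℤP
open import Data.Rational using (_*_; _-_; _/_)
open import Relation.Binary.PropositionalEquality using (_≡_; sym; trans; cong; cong₂; subst; subst₂)
open import Relation.Nullary using (¬_)
open Integers using (module Modulo; module OddPrime; module ModuloPrime; Δ; [-1]^[t+t]≡1; odd-prime∤2)
open Rationals using (fromℕ; a; 4*16^n*∑≡n²Δ; ≡0modℤp-intro)

m^[2r]≡m^r*m^r : ∀ m r → m ^ (2 ℕ.* r) ≡ m ^ r ℕ.* m ^ r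
m^[2r]≡m^r*m^r m r = trans (cong (λ e → m ^ (r ℕ.+ e)) (ℕP.+-identityʳ r)) (ℕP.^-distribˡ-+-* m r r)

module _ (t : ℕ) (prime : Prime (suc ((t ℕ.+ t) ℕ.+ (t ℕ.+ t)))) where
  open OddPrime (t ℕ.+ t) prime using (p; Δ[p^r]≈0)
  open Modulo p using (≈0⇒∣)
  open ModuloPrime prime using (p∤a⇒p∤a^k)

  p∤4*16^n : ∀ n → ¬ p ∣ 4 ℕ.* 16 ^ n
  p∤4*16^n n = subst (λ D → ¬ p ∣ D) 2^[2+4n]≡4*16^n (p∤a⇒p∤a^k (odd-prime∤2 (t ℕ.+ t) prime) (2 ℕ.+ 4 ℕ.* n))
    where
    2^[2+4n]≡4*16^n : 2 ^ (2 ℕ.+ 4 ℕ.* n) ≡ 4 ℕ.* 16 ^ n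
    2^[2+4n]≡4*16^n = trans (ℕP.^-distribˡ-+-* 2 2 (4 ℕ.* n)) (cong (4 ℕ.*_) (sym (ℕP.^-*-assoc 2 4 n)))

  theorem-for-1+4t : ∀ r → ≡0modℤp p (2 ℕ.* r ℕ.+ 1) (sumTo (p ^ r) (λ k → (fromℕ k - ℤ.+ (p ^ (2 ℕ.* r) ∸ 1) / 4) * a k))
  theorem-for-1+4t r rewrite m^[2r]≡m^r*m^r p r =
    ≡0modℤp-intro prime (2 ℕ.* r ℕ.+ 1) x (ℤ.+ (n ℕ.* n) ℤ.* Δ n) (p∤4*16^n n) (4*16^n*∑≡n²Δ n 1≤n) p^[2r+1]∣n²Δ
    where
    n = p ^ r
    x = sumTo n (λ k → (fromℕ k - ℤ.+ (n ℕ.* n ∸ 1) / 4) * a k)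
    1≤n : 1 ℕ.≤ n
    1≤n = ℕP.m^n>0 p {{ℕ.>-nonZero (s≤s z≤n)}} r
    p^[2r+1]∣n²Δ : p ^ (2 ℕ.* r ℕ.+ 1) ∣ ℤ.∣ ℤ.+ (n ℕ.* n) ℤ.* Δ n ∣
    p^[2r+1]∣n²Δ = subst₂ _∣_ p^[2r+1]≡n*n*p (sym (ℤP.abs-* (ℤ.+ (n ℕ.* n)) (Δ n)))
                     (ℕD.*-monoʳ-∣ (n ℕ.* n) (≈0⇒∣ (Δ[p^r]≈0 ([-1]^[t+t]≡1 t) r)))
      where
      p^[2r+1]≡n*n*p : n ℕ.* n ℕ.* p ≡ p ^ (2 ℕ.* r ℕ.+ 1)
      p^[2r+1]≡n*n*p = sym (trans (ℕP.^-distribˡ-+-* p (2 ℕ.* r) 1) (cong₂ ℕ._*_ (m^[2r]≡m^r*m^r p r) (ℕP.*-identityʳ p)))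

p%4≡1⇒p≡1+4[p/4] : ∀ p → p % 4 ≡ 1 → p ≡ suc ((p ℕ./ 4 ℕ.+ p ℕ./ 4) ℕ.+ (p ℕ./ 4 ℕ.+ p ℕ./ 4))
p%4≡1⇒p≡1+4[p/4] p p%4≡1 = trans (m≡m%n+[m/n]*n p 4) (trans (cong (ℕ._+ p ℕ./ 4 ℕ.* 4) p%4≡1) (1+t*4≡1+4t (p ℕ./ 4)))
  where
  1+t*4≡1+4t : ∀ t → 1 ℕ.+ t ℕ.* 4 ≡ suc ((t ℕ.+ t) ℕ.+ (t ℕ.+ t))
  1+t*4≡1+4t = ℕSolver.solve-∀

theorem1p2 : (p r : ℕ) → Prime p → p % 4 ≡ 1 → r ≥ 1 →
    ≡0modℤp p (2 ℕ.* r ℕ.+ 1)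
      (sumTo (p ^ r) (λ k →
        ((ℤ.+ k) / 1 - ℤ.+ (p ^ (2 ℕ.* r) ∸ 1) / 4)
          * (poch (ℤ.+ 1 / 2) k * poch (ℤ.+ 1 / 2) k * (invFact k * invFact k))))
theorem1p2 p r p-prime p%4≡1 _ =
  subst (λ q → ≡0modℤp q (2 ℕ.* r ℕ.+ 1) (sumTo (q ^ r) (λ k → (fromℕ k - ℤ.+ (q ^ (2 ℕ.* r) ∸ 1) / 4) * a k)))
        (sym p≡1+4t) (theorem-for-1+4t t (subst Prime p≡1+4t p-prime) r)
  where
  t : ℕ
  t = p ℕ./ 4
  p≡1+4t : p ≡ suc ((t ℕ.+ t) ℕ.+ (t ℕ.+ t))
  p≡1+4t = p%4≡1⇒p≡1+4[p/4] p p%4≡1
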